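{- Let $G$ be a bipartite graph and let $T$ be an optimal tetragonal subgraph of $G$ with $|V(T)|=2m\ge 6$. Then: (1) every $v\in V(G)\setminus V(T)$ satisfies $\deg_T(v)\le m$, and equality holds for some such $v$ only if $G[V(T)]\cong K_{m,m}$; (2) the set $R:=\{v\in V(G)\setminus V(T):\deg_T(v)\ge m-1\}$ is independent in $G$; (3) if $m\ge 4$, then $R$ is contained in one of the two partite sets of $G$; (4) every $v\in V(G)\setminus(V(T)\cup R)$ satisfies exactly one of: (4.1) $\deg_R(v)=0$ and $\deg_T(v)\le m-2$; (4.2) $\deg_R(v)=1$ and $\deg_T(v)=0$.
   Context: A tetragonal graph is a graph $T$ with a Hamiltonian cycle $\partial T$, obtained from $C_4$ (with boundary itself) by repeatedly choosing an edge $ab$ of the current boundary cycle, adding two new vertices $x,y$ and the path $axyb$, and replacing $ab$ by $axyb$ in the boundary cycle. A tetragonal subgraph of $G$ is a subgraph of $G$ which is a tetragonal graph (for some choice of boundary cycle). A tetragonal subgraph $T$ of $G$ is optimal if it has maximum order among tetragonal subgraphs of $G$ and, subject to this, the induced subgraph $G[V(T)]$ has the maximum number of edges. For a vertex set or subgraph $X$, $\deg_X(v)$ is the number of neighbours of $v$ in $X$. -}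

module Defs where

open import Data.Nat using (ℕ; _≤_; _<_; _<ᵇ_; _≤ᵇ_; _∸_)
open import Data.Nat.Properties using ()
open import Data.Bool using (Bool; true; false; _∧_; not)
open import Data.Fin using (Fin; toℕ)
open import Data.Fin.Properties using (_≟_)
open import Data.List using (List; []; _∷_; _++_; [_]; length; filterᵇ; allFin; cartesianProduct)
open import Data.List.Membership.Propositional using (_∈_; _∉_)
import Data.List.Membership.DecPropositional
open import Data.Product using (_×_; _,_; Σ; ∃; proj₁; proj₂)
open import Data.Sum using (_⊎_; inj₁; inj₂)
open import Relation.Binary.PropositionalEquality using (_≡_; _≢_)
open import Relation.Nullary using (does)
open import Function using (_⇔_)

-- A finite simple graph on the vertex set Fin n, with decidable (Bool-valued)
-- adjacency, together with a fixed bipartition (partite sets = colour classes).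
record BipartiteGraph : Set where
  field
    n      : ℕ
    adj    : Fin n → Fin n → Bool
    sym    : ∀ u v → adj u v ≡ adj v u
    irrefl : ∀ v → adj v v ≡ false
    side   : Fin n → Bool
    proper : ∀ u v → adj u v ≡ true → side u ≢ side v

-- Tet E B : the graph with edge list E is a tetragonal graph with boundary
-- Hamiltonian cycle B (listed cyclically; its vertex set is the set of
-- elements of B).
data Tet {n : ℕ} : List (Fin n × Fin n) → List (Fin n) → Set where
  c4  : (a b c d : Fin n) →
        a ≢ b → a ≢ c → a ≢ d → b ≢ c → b ≢ d → c ≢ d →
        Tet ((a , b) ∷ (b , c) ∷ (c , d) ∷ (d , a) ∷ []) (a ∷ b ∷ c ∷ d ∷ [])
  rot : ∀ {E v vs} → Tet E (v ∷ vs) → Tet E (vs ++ [ v ])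
  ext : ∀ {E a b rest} (x y : Fin n) → Tet E (a ∷ b ∷ rest) →
        x ∉ (a ∷ b ∷ rest) → y ∉ (a ∷ b ∷ rest) → x ≢ y →
        Tet ((a , x) ∷ (x , y) ∷ (y , b) ∷ E) (a ∷ x ∷ y ∷ b ∷ rest)

module _ (G : BipartiteGraph) where
  open BipartiteGraph G
  private module DM = Data.List.Membership.DecPropositional (_≟_ {n = n})

  SubgraphOf : List (Fin n × Fin n) → Set
  SubgraphOf E = ∀ {u v} → (u , v) ∈ E → adj u v ≡ true

  TetSub : List (Fin n × Fin n) → List (Fin n) → Set
  TetSub E B = Tet E B × SubgraphOf E

  inB : List (Fin n) → Fin n → Bool
  inB B v = does (v DM.∈? B)

  inducedEdges : List (Fin n) → ℕ
  inducedEdges B = length (filterᵇ ok (cartesianProduct (allFin n) (allFin n)))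
    where
    ok : Fin n × Fin n → Bool
    ok (u , v) = (toℕ u <ᵇ toℕ v) ∧ inB B u ∧ inB B v ∧ adj u v

  Optimal : List (Fin n × Fin n) → List (Fin n) → Set
  Optimal E B = TetSub E B ×
    (∀ E' B' → TetSub E' B' →
       length B' ≤ length B × (length B' ≡ length B → inducedEdges B' ≤ inducedEdges B))

  degP : (Fin n → Bool) → Fin n → ℕ
  degP X v = length (filterᵇ (λ u → X u ∧ adj v u) (allFin n))

  Kadj : {m : ℕ} → Fin m ⊎ Fin m → Fin m ⊎ Fin m → Bool
  Kadj (inj₁ _) (inj₁ _) = false
  Kadj (inj₁ _) (inj₂ _) = true
  Kadj (inj₂ _) (inj₁ _) = true
  Kadj (inj₂ _) (inj₂ _) = false

  InducedIsoKmm : List (Fin n) → ℕ → Set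
  InducedIsoKmm B m = Σ (Fin m ⊎ Fin m → Fin n) λ σ →
      (∀ x y → σ x ≡ σ y → x ≡ y)
    × (∀ x → σ x ∈ B)
    × (∀ v → v ∈ B → ∃ λ x → σ x ≡ v)
    × (∀ x y → adj (σ x) (σ y) ≡ Kadj x y)

  degT : List (Fin n) → Fin n → ℕ
  degT B = degP (inB B)

  inR : List (Fin n) → ℕ → Fin n → Bool
  inR B m v = not (inB B v) ∧ ((m ∸ 1) ≤ᵇ degT B v)

-- The boundary cycle of T alternates between the two sides of G, so each side of T has m vertices
-- and a vertex outside T has at most m neighbours in T.  Everything else is a contradiction with
-- optimality: we build a tetragonal subgraph with more vertices, or with as many vertices and more
-- induced edges.  A vertex r ∈ R misses at most one vertex of the other side of T, so a path r w t
-- with w ∉ T, t ∈ T closes into the ear t w r s; this gives (2) and most of (4).  Two R-neighbours of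
-- one vertex, or two vertices of R on different sides, are excluded by removing an ear of T away from
-- a prescribed boundary edge (every tetragonal graph on at least six vertices has such an ear),
-- re-attaching an ear through a vertex of R and then one more ear, or for (3) by a double fan built
-- from scratch.  If v ∉ T has m neighbours in T and G[V(T)] misses an edge a b, then a fan around v
-- replaces b and gains induced edges, so G[V(T)] is complete bipartite.

module Submission where

open import Defs
open import Data.Bool using (Bool; true; false; _∧_; _∨_; not; _xor_; if_then_else_)
import Data.Bool as Bool
open import Data.Bool.Properties
  using (T?; not-¬; not-injective; not-involutive; not-distribʳ-xor; xor-same; ∧-comm; ∧-zeroʳ; ∧-identityʳ;
         ∧-conicalˡ; ∧-conicalʳ)
open import Data.Empty using (⊥; ⊥-elim)
open import Data.Fin using (Fin; zero; suc; toℕ)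
open import Data.Fin.Properties using (_≟_; toℕ-injective)
open import Data.List using (List; []; _∷_; _++_; [_]; length; filterᵇ; map; allFin; cartesianProduct; lookup; initLast; _∷ʳ′_)
open import Data.List.Membership.Propositional using (_∈_; _∉_)
open import Data.List.Membership.Propositional.Properties using (∈-++⁺ˡ; ∈-++⁺ʳ; ∈-++⁻; ∈-∃++; ∈-allFin; ∈-lookup)
open import Data.List.Properties using (++-assoc; ++-identityʳ; length-++; ∷-injectiveˡ; ∷-injectiveʳ)
open import Data.List.Relation.Binary.Subset.Propositional using (_⊆_)
open import Data.List.Relation.Unary.All using (All; []; _∷_)
import Data.List.Relation.Unary.All as All
open import Data.List.Relation.Unary.All.Properties using (All¬⇒¬Any; ¬Any⇒All¬) renaming (++⁻ˡ to All-++⁻ˡ)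
open import Data.List.Relation.Unary.Any using (here; there; index)
open import Data.List.Relation.Unary.Any.Properties using (lookup-index)
open import Data.List.Relation.Unary.Unique.Propositional using (Unique; []; _∷_)
open import Data.List.Relation.Unary.Unique.Propositional.Properties using (Unique[x∷xs]⇒x∉xs; ++⁺; filter⁺; allFin⁺; drop⁺)
open import Data.Nat using (ℕ; zero; suc; _+_; _*_; _∸_; _≤_; _<_; _<ᵇ_; _≤ᵇ_; z≤n; s≤s)
open import Data.Nat.Properties
  using (suc-injective; +-suc; +-comm; +-identityʳ; *-identityʳ; ≤-refl; ≤-trans; ≤-antisym; ≤-pred; n≤1+n; n<1+n;
         1+n≰n; m<n⇒m<1+n; <-irrefl; <-asym; <⇒≱; ≮⇒≥; ≰⇒>; <⇒≤pred; <ᵇ⇒<; <⇒<ᵇ; ≤ᵇ⇒≤; ≤⇒≤ᵇ;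
         +-mono-≤; +-monoʳ-≤; +-monoʳ-<; +-cancelˡ-≤)
open import Data.Product using (_×_; _,_; ∃; ∃₂; proj₁; proj₂; swap; map₁)
open import Data.Sum using (_⊎_; inj₁; inj₂; [_,_]′)
import Data.Sum as Sum
open import Data.Unit using (tt)
open import Function using (_∘_)
open import Relation.Binary.PropositionalEquality
  using (_≡_; _≢_; refl; sym; trans; cong; cong₂; subst; subst₂; module ≡-Reasoning)
open import Relation.Nullary using (¬_; Dec; yes; no; does)
open import Relation.Nullary.Decidable using (decidable-stable)

double-pred : ∀ {l k} → suc (suc l) ≡ suc k + suc k → l ≡ k + k
double-pred {k = k} e = suc-injective (trans (suc-injective e) (+-suc k k))

<ᵇ-irrefl : ∀ m → (m <ᵇ m) ≡ false
<ᵇ-irrefl m with m <ᵇ m in m<m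
... | false = refl
... | true = ⊥-elim (<-irrefl refl (<ᵇ⇒< m m (subst Bool.T (sym m<m) tt)))

<ᵇ-flip : ∀ {m n} → m ≢ n → not (n <ᵇ m) ≡ (m <ᵇ n)
<ᵇ-flip {m} {n} m≢n with m <ᵇ n in m<n | n <ᵇ m in n<m
... | true | false = refl
... | false | true = refl
... | true | true = ⊥-elim (<-asym (<ᵇ⇒< m n (subst Bool.T (sym m<n) tt)) (<ᵇ⇒< n m (subst Bool.T (sym n<m) tt)))
... | false | false = ⊥-elim (m≢n (≤-antisym (≮⇒≥ (λ n<m′ → subst Bool.T n<m (<⇒<ᵇ n<m′)))
                                            (≮⇒≥ (λ m<n′ → subst Bool.T m<n (<⇒<ᵇ m<n′)))))

-- Counting and enumerating list elements

module _ {A : Set} where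

  countᵇ : (A → Bool) → List A → ℕ
  countᵇ f [] = 0
  countᵇ f (x ∷ xs) = if f x then suc (countᵇ f xs) else countᵇ f xs

  length-filterᵇ : ∀ f (xs : List A) → length (filterᵇ f xs) ≡ countᵇ f xs
  length-filterᵇ f [] = refl
  length-filterᵇ f (x ∷ xs) with f x
  ... | true = cong suc (length-filterᵇ f xs)
  ... | false = length-filterᵇ f xs

  countᵇ-∷-true : ∀ {f x} xs → f x ≡ true → countᵇ f (x ∷ xs) ≡ suc (countᵇ f xs)
  countᵇ-∷-true xs fx rewrite fx = refl

  countᵇ-∷-false : ∀ {f x} xs → f x ≡ false → countᵇ f (x ∷ xs) ≡ countᵇ f xs
  countᵇ-∷-false xs fx rewrite fx = refl

  countᵇ-cong : ∀ {f g} xs → (∀ {x} → x ∈ xs → f x ≡ g x) → countᵇ f xs ≡ countᵇ g xs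
  countᵇ-cong [] f≗g = refl
  countᵇ-cong {f} {g} (x ∷ xs) f≗g with f x | g x | f≗g (here refl)
  ... | true | true | _ = cong suc (countᵇ-cong xs (f≗g ∘ there))
  ... | false | false | _ = countᵇ-cong xs (f≗g ∘ there)

  countᵇ-mono : ∀ {f g} xs → (∀ {x} → x ∈ xs → f x ≡ true → g x ≡ true) → countᵇ f xs ≤ countᵇ g xs
  countᵇ-mono [] f⇒g = z≤n
  countᵇ-mono {f} {g} (x ∷ xs) f⇒g with f x | g x | f⇒g (here refl)
  ... | true | true | _ = s≤s (countᵇ-mono xs (f⇒g ∘ there))
  ... | false | true | _ = ≤-trans (countᵇ-mono xs (f⇒g ∘ there)) (n≤1+n _)
  ... | false | false | _ = countᵇ-mono xs (f⇒g ∘ there)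
  ... | true | false | fx⇒gx with () ← fx⇒gx refl

  countᵇ-mono-tight : ∀ {f g} xs → (∀ {x} → x ∈ xs → f x ≡ true → g x ≡ true) →
                      countᵇ g xs ≤ countᵇ f xs → ∀ {x} → x ∈ xs → g x ≡ true → f x ≡ true
  countᵇ-mono-tight {f} {g} (x ∷ xs) f⇒g g≤f (here refl) gx with f x | g x | f⇒g (here refl)
  ... | true | _ | _ = refl
  ... | false | false | _ with () ← gx
  ... | false | true | _ = ⊥-elim (1+n≰n (≤-trans g≤f (countᵇ-mono xs (f⇒g ∘ there))))
  countᵇ-mono-tight {f} {g} (x ∷ xs) f⇒g g≤f (there y∈xs) gy with f x | g x | f⇒g (here refl)
  ... | true | true | _ = countᵇ-mono-tight xs (f⇒g ∘ there) (≤-pred g≤f) y∈xs gy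
  ... | false | true | _ = countᵇ-mono-tight xs (f⇒g ∘ there) (≤-trans (n≤1+n _) g≤f) y∈xs gy
  ... | false | false | _ = countᵇ-mono-tight xs (f⇒g ∘ there) g≤f y∈xs gy
  ... | true | false | fx⇒gx with () ← fx⇒gx refl

  countᵇ-none : ∀ {f} xs → (∀ {x} → x ∈ xs → f x ≡ false) → countᵇ f xs ≡ 0
  countᵇ-none [] none = refl
  countᵇ-none {f} (x ∷ xs) none with f x | none (here refl)
  ... | false | _ = countᵇ-none xs (none ∘ there)

  countᵇ-witness : ∀ {f} xs → 0 < countᵇ f xs → ∃ λ x → x ∈ xs × f x ≡ true
  countᵇ-witness {f} (x ∷ xs) pos with f x in fx
  ... | true = x , here refl , fx
  ... | false with y , y∈xs , fy ← countᵇ-witness xs pos = y , there y∈xs , fy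

  countᵇ-++ : ∀ f xs ys → countᵇ f (xs ++ ys) ≡ countᵇ f xs + countᵇ f ys
  countᵇ-++ f [] ys = refl
  countᵇ-++ f (x ∷ xs) ys with f x
  ... | true = cong suc (countᵇ-++ f xs ys)
  ... | false = countᵇ-++ f xs ys

  countᵇ-insert-true : ∀ {f x} ys zs → f x ≡ true → countᵇ f (ys ++ x ∷ zs) ≡ suc (countᵇ f (ys ++ zs))
  countᵇ-insert-true [] zs fx = countᵇ-∷-true zs fx
  countᵇ-insert-true {f} (y ∷ ys) zs fx with f y
  ... | true = cong suc (countᵇ-insert-true ys zs fx)
  ... | false = countᵇ-insert-true ys zs fx

  countᵇ-insert-false : ∀ {f x} ys zs → f x ≡ false → countᵇ f (ys ++ x ∷ zs) ≡ countᵇ f (ys ++ zs)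
  countᵇ-insert-false [] zs fx = countᵇ-∷-false zs fx
  countᵇ-insert-false {f} (y ∷ ys) zs fx with f y
  ... | true = cong suc (countᵇ-insert-false ys zs fx)
  ... | false = countᵇ-insert-false ys zs fx

  findᵇ : ∀ (f : A → Bool) xs → (∃ λ x → x ∈ xs × f x ≡ true) ⊎ (∀ {x} → x ∈ xs → f x ≡ false)
  findᵇ f [] = inj₂ λ ()
  findᵇ f (x ∷ xs) with f x in fx | findᵇ f xs
  ... | true | _ = inj₁ (x , here refl , fx)
  ... | false | inj₁ (y , y∈xs , fy) = inj₁ (y , there y∈xs , fy)
  ... | false | inj₂ none = inj₂ λ { (here refl) → fx ; (there y∈xs) → none y∈xs }

  countᵇ-split : ∀ (f h : A → Bool) xs →
                 countᵇ f xs ≡ countᵇ (λ x → f x ∧ h x) xs + countᵇ (λ x → f x ∧ not (h x)) xs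
  countᵇ-split f h [] = refl
  countᵇ-split f h (x ∷ xs) with f x | h x
  ... | true | true = cong suc (countᵇ-split f h xs)
  ... | true | false = trans (cong suc (countᵇ-split f h xs)) (sym (+-suc _ _))
  ... | false | _ = countᵇ-split f h xs

  countᵇ-injection : ∀ {f g} xs ys → Unique xs →
                     (∀ {x} → x ∈ xs → f x ≡ true → x ∈ ys × g x ≡ true) → countᵇ f xs ≤ countᵇ g ys
  countᵇ-injection [] ys _ _ = z≤n
  countᵇ-injection {f} {g} (x ∷ xs) ys (x≢xs ∷ uxs) into with f x in fx
  ... | false = countᵇ-injection xs ys uxs (into ∘ there)
  ... | true with into (here refl) fx
  ... | x∈ys , gx with ys₁ , ys₂ , refl ← ∈-∃++ x∈ys =
    subst (suc (countᵇ f xs) ≤_) (sym (countᵇ-insert-true ys₁ ys₂ gx))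
          (s≤s (countᵇ-injection xs (ys₁ ++ ys₂) uxs into′))
    where
    x∉xs = Unique[x∷xs]⇒x∉xs (x≢xs ∷ uxs)
    into′ : ∀ {y} → y ∈ xs → f y ≡ true → y ∈ ys₁ ++ ys₂ × g y ≡ true
    into′ y∈xs fy with y∈ys , gy ← into (there y∈xs) fy with ∈-++⁻ ys₁ y∈ys
    ... | inj₁ y∈ys₁ = ∈-++⁺ˡ y∈ys₁ , gy
    ... | inj₂ (here refl) = ⊥-elim (x∉xs y∈xs)
    ... | inj₂ (there y∈ys₂) = ∈-++⁺ʳ ys₁ y∈ys₂ , gy

  countᵇ-unique : ∀ {f x} xs → Unique xs → x ∈ xs → f x ≡ true → (∀ {y} → y ∈ xs → f y ≡ true → y ≡ x) →
                  countᵇ f xs ≡ 1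
  countᵇ-unique {x = x} xs u x∈xs fx only = ≤-antisym
    (countᵇ-injection {g = λ _ → true} xs [ x ] u λ y∈xs fy → here (only y∈xs fy) , refl)
    (countᵇ-injection {f = λ _ → true} [ x ] xs ([] ∷ []) λ { (here refl) _ → x∈xs , fx })

  ∈-filterᵇ⁻ : ∀ {f : A → Bool} {x} xs → x ∈ filterᵇ f xs → x ∈ xs × f x ≡ true
  ∈-filterᵇ⁻ {f} (y ∷ xs) x∈ with f y in fy
  ∈-filterᵇ⁻ (y ∷ xs) (here refl) | true = here refl , fy
  ∈-filterᵇ⁻ (y ∷ xs) (there x∈) | true = map₁ there (∈-filterᵇ⁻ xs x∈)
  ∈-filterᵇ⁻ (y ∷ xs) x∈ | false = map₁ there (∈-filterᵇ⁻ xs x∈)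

  ∈-filterᵇ⁺ : ∀ {f : A → Bool} {x xs} → x ∈ xs → f x ≡ true → x ∈ filterᵇ f xs
  ∈-filterᵇ⁺ {f} {xs = y ∷ xs} x∈ fx with f y in fy
  ∈-filterᵇ⁺ (here refl) fx | true = here refl
  ∈-filterᵇ⁺ (there x∈) fx | true = there (∈-filterᵇ⁺ x∈ fx)
  ∈-filterᵇ⁺ (here refl) fx | false with () ← trans (sym fx) fy
  ∈-filterᵇ⁺ (there x∈) fx | false = ∈-filterᵇ⁺ x∈ fx

  Unique-filterᵇ : ∀ {f : A → Bool} {xs} → Unique xs → Unique (filterᵇ f xs)
  Unique-filterᵇ {f} = filter⁺ (T? ∘ f)

  lookup-injective : ∀ {xs : List A} → Unique xs → ∀ {i j} → lookup xs i ≡ lookup xs j → i ≡ j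
  lookup-injective {x ∷ xs} u {zero} {zero} _ = refl
  lookup-injective {x ∷ xs} u {zero} {suc j} x≡ = ⊥-elim (Unique[x∷xs]⇒x∉xs u (subst (_∈ xs) (sym x≡) (∈-lookup j)))
  lookup-injective {x ∷ xs} u {suc i} {zero} ≡x = ⊥-elim (Unique[x∷xs]⇒x∉xs u (subst (_∈ xs) ≡x (∈-lookup i)))
  lookup-injective {x ∷ xs} (_ ∷ u) {suc i} {suc j} e = cong suc (lookup-injective u e)

  enumerate : ∀ {m} (xs : List A) → length xs ≡ m → Fin m → A
  enumerate xs refl = lookup xs

  enumerate-∈ : ∀ {m} (xs : List A) (e : length xs ≡ m) i → enumerate xs e i ∈ xs
  enumerate-∈ xs refl = ∈-lookup

  enumerate-injective : ∀ {m} {xs : List A} (e : length xs ≡ m) → Unique xs →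
                        ∀ {i j} → enumerate xs e i ≡ enumerate xs e j → i ≡ j
  enumerate-injective refl = lookup-injective

  enumerate-surjective : ∀ {m} {x : A} {xs} (e : length xs ≡ m) → x ∈ xs → ∃ λ i → enumerate xs e i ≡ x
  enumerate-surjective refl x∈ = index x∈ , sym (lookup-index x∈)

  ∷-view : ∀ xs (y : A) ys → ∃₂ λ h t → xs ++ y ∷ ys ≡ h ∷ t
  ∷-view [] y ys = y , ys , refl
  ∷-view (x ∷ xs) y ys = x , xs ++ y ∷ ys , refl

  data AtLeast7 : List A → Set where
    _∷_∷_∷_∷_∷_∷_∷ʳ_ : ∀ x₁ x₂ x₃ x₄ x₅ x₆ xs x₇ →
                       AtLeast7 (x₁ ∷ x₂ ∷ x₃ ∷ x₄ ∷ x₅ ∷ x₆ ∷ xs ++ [ x₇ ])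

  atLeast7 : ∀ xs → 7 ≤ length xs → AtLeast7 xs
  atLeast7 (_ ∷ _ ∷ _ ∷ _ ∷ _ ∷ _ ∷ rest) 7≤ with initLast rest | 7≤
  ... | [] | s≤s (s≤s (s≤s (s≤s (s≤s (s≤s ())))))
  ... | xs ∷ʳ′ x₇ | _ = _ ∷ _ ∷ _ ∷ _ ∷ _ ∷ _ ∷ xs ∷ʳ x₇
  atLeast7 [] ()
  atLeast7 (_ ∷ []) (s≤s ())
  atLeast7 (_ ∷ _ ∷ []) (s≤s (s≤s ()))
  atLeast7 (_ ∷ _ ∷ _ ∷ []) (s≤s (s≤s (s≤s ())))
  atLeast7 (_ ∷ _ ∷ _ ∷ _ ∷ []) (s≤s (s≤s (s≤s (s≤s ()))))
  atLeast7 (_ ∷ _ ∷ _ ∷ _ ∷ _ ∷ []) (s≤s (s≤s (s≤s (s≤s (s≤s ())))))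

module _ {A B : Set} where

  countᵇ-map : ∀ (f : B → Bool) (g : A → B) xs → countᵇ f (map g xs) ≡ countᵇ (f ∘ g) xs
  countᵇ-map f g [] = refl
  countᵇ-map f g (x ∷ xs) with f (g x)
  ... | true = cong suc (countᵇ-map f g xs)
  ... | false = countᵇ-map f g xs

module _ {A B : Set} where

  countᵇ-cartesianProduct : ∀ (f : A → Bool) (g : B → Bool) xs ys →
    countᵇ (λ p → f (proj₁ p) ∧ g (proj₂ p)) (cartesianProduct xs ys) ≡ countᵇ f xs * countᵇ g ys
  countᵇ-cartesianProduct f g [] ys = refl
  countᵇ-cartesianProduct f g (x ∷ xs) ys = begin
    countᵇ fg (map (x ,_) ys ++ cartesianProduct xs ys)          ≡⟨ countᵇ-++ fg (map (x ,_) ys) _ ⟩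
    countᵇ fg (map (x ,_) ys) + countᵇ fg (cartesianProduct xs ys) ≡⟨ cong₂ _+_ (countᵇ-map fg (x ,_) ys)
                                                                         (countᵇ-cartesianProduct f g xs ys) ⟩
    countᵇ (λ y → f x ∧ g y) ys + countᵇ f xs * countᵇ g ys       ≡⟨ row (f x) ⟩
    countᵇ f (x ∷ xs) * countᵇ g ys                               ∎
    where
    open ≡-Reasoning
    fg = λ (p : A × B) → f (proj₁ p) ∧ g (proj₂ p)
    row : ∀ b → countᵇ (λ y → b ∧ g y) ys + countᵇ f xs * countᵇ g ys ≡
                (if b then suc (countᵇ f xs) else countᵇ f xs) * countᵇ g ys
    row true = refl
    row false = cong (_+ countᵇ f xs * countᵇ g ys) (countᵇ-none ys λ _ → refl)

-- Cycles as lists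

module _ {A : Set} where

  data Consecutive (x y : A) : List A → Set where
    here  : ∀ {zs} → Consecutive x y (x ∷ y ∷ zs)
    there : ∀ {z zs} → Consecutive x y zs → Consecutive x y (z ∷ zs)

  data CyclicConsecutive (x y : A) (zs : List A) : Set where
    inner : Consecutive x y zs → CyclicConsecutive x y zs
    wrap  : ∀ ws → zs ≡ y ∷ ws ++ [ x ] → CyclicConsecutive x y zs

  CycleEdge : A → A → List A → Set
  CycleEdge x y zs = CyclicConsecutive x y zs ⊎ CyclicConsecutive y x zs

  Rotation : List A → List A → Set
  Rotation xs ys = ∃₂ λ p r → xs ≡ p ++ r × ys ≡ r ++ p

  Consecutive-++⁺ʳ : ∀ {x y xs} ys → Consecutive x y xs → Consecutive x y (xs ++ ys)
  Consecutive-++⁺ʳ ys here = here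
  Consecutive-++⁺ʳ ys (there c) = there (Consecutive-++⁺ʳ ys c)

  Consecutive-++⁺ˡ : ∀ {x y xs} ws → Consecutive x y xs → Consecutive x y (ws ++ xs)
  Consecutive-++⁺ˡ [] c = c
  Consecutive-++⁺ˡ (w ∷ ws) c = there (Consecutive-++⁺ˡ ws c)

  Consecutive-split : ∀ {x y zs} → Consecutive x y zs → ∃₂ λ ws vs → zs ≡ ws ++ x ∷ y ∷ vs
  Consecutive-split (here {zs}) = [] , zs , refl
  Consecutive-split (there {z} c) with ws , vs , refl ← Consecutive-split c = z ∷ ws , vs , refl

  Consecutive⇒∈ˡ : ∀ {x y zs} → Consecutive x y zs → x ∈ zs
  Consecutive⇒∈ˡ here = here refl
  Consecutive⇒∈ˡ (there c) = there (Consecutive⇒∈ˡ c)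

  Consecutive⇒∈ʳ : ∀ {x y zs} → Consecutive x y zs → y ∈ zs
  Consecutive⇒∈ʳ here = there (here refl)
  Consecutive⇒∈ʳ (there c) = there (Consecutive⇒∈ʳ c)

  Consecutive-uncons : ∀ {x y z zs} → Consecutive x y (z ∷ zs) → x ≡ z ⊎ Consecutive x y zs
  Consecutive-uncons here = inj₁ refl
  Consecutive-uncons (there c) = inj₂ c

  Consecutive-∷ʳ : ∀ {x y z} ws → Consecutive x y (ws ++ [ z ]) → x ∈ ws
  Consecutive-∷ʳ [] (there ())
  Consecutive-∷ʳ (w ∷ ws) c with Consecutive-uncons c
  ... | inj₁ x≡w = here x≡w
  ... | inj₂ c′ = there (Consecutive-∷ʳ ws c′)

  Consecutive-functional : ∀ {x y y′ zs} → Unique zs → Consecutive x y zs → Consecutive x y′ zs → y ≡ y′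
  Consecutive-functional _ here here = refl
  Consecutive-functional u here (there c) = ⊥-elim (Unique[x∷xs]⇒x∉xs u (Consecutive⇒∈ˡ c))
  Consecutive-functional u (there c) here = ⊥-elim (Unique[x∷xs]⇒x∉xs u (Consecutive⇒∈ˡ c))
  Consecutive-functional (_ ∷ u) (there c) (there c′) = Consecutive-functional u c c′

  CyclicConsecutive⇒∈ˡ : ∀ {x y zs} → CyclicConsecutive x y zs → x ∈ zs
  CyclicConsecutive⇒∈ˡ (inner c) = Consecutive⇒∈ˡ c
  CyclicConsecutive⇒∈ˡ (wrap ws refl) = there (∈-++⁺ʳ ws (here refl))

  CyclicConsecutive⇒∈ʳ : ∀ {x y zs} → CyclicConsecutive x y zs → y ∈ zs
  CyclicConsecutive⇒∈ʳ (inner c) = Consecutive⇒∈ʳ c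
  CyclicConsecutive⇒∈ʳ (wrap ws refl) = here refl

  CycleEdge⇒∈ˡ : ∀ {x y zs} → CycleEdge x y zs → x ∈ zs
  CycleEdge⇒∈ˡ (inj₁ xy) = CyclicConsecutive⇒∈ˡ xy
  CycleEdge⇒∈ˡ (inj₂ yx) = CyclicConsecutive⇒∈ʳ yx

  CycleEdge⇒∈ʳ : ∀ {x y zs} → CycleEdge x y zs → y ∈ zs
  CycleEdge⇒∈ʳ (inj₁ xy) = CyclicConsecutive⇒∈ʳ xy
  CycleEdge⇒∈ʳ (inj₂ yx) = CyclicConsecutive⇒∈ˡ yx

  ∉-≢ : ∀ {w c : A} {L} → w ∉ L → c ∈ L → w ≢ c
  ∉-≢ w∉ c∈ refl = w∉ c∈

  Unique-++⇒≢ : ∀ {x y : A} xs {ys} → Unique (xs ++ ys) → x ∈ xs → y ∈ ys → x ≢ y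
  Unique-++⇒≢ (w ∷ xs) u (here refl) y∈ys refl = Unique[x∷xs]⇒x∉xs u (∈-++⁺ʳ xs y∈ys)
  Unique-++⇒≢ (w ∷ xs) (_ ∷ u) (there x∈xs) y∈ys = Unique-++⇒≢ xs u x∈xs y∈ys

  Unique-++⁻ˡ : ∀ xs {ys : List A} → Unique (xs ++ ys) → Unique xs
  Unique-++⁻ˡ [] _ = []
  Unique-++⁻ˡ (x ∷ xs) (x≢ ∷ u) = All-++⁻ˡ xs x≢ ∷ Unique-++⁻ˡ xs u

  Unique-∷ʳ⇒∉ : ∀ {z : A} ws → Unique (ws ++ [ z ]) → z ∉ ws
  Unique-∷ʳ⇒∉ (w ∷ ws) u (here refl) = Unique[x∷xs]⇒x∉xs u (∈-++⁺ʳ ws (here refl))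
  Unique-∷ʳ⇒∉ (w ∷ ws) (_ ∷ u) (there z∈ws) = Unique-∷ʳ⇒∉ ws u z∈ws

  CyclicConsecutive-functional : ∀ {x y y′ zs} → Unique zs →
                                 CyclicConsecutive x y zs → CyclicConsecutive x y′ zs → y ≡ y′
  CyclicConsecutive-functional u (inner c) (inner c′) = Consecutive-functional u c c′
  CyclicConsecutive-functional u (inner c) (wrap ws refl) = ⊥-elim (Unique-∷ʳ⇒∉ (_ ∷ ws) u (Consecutive-∷ʳ (_ ∷ ws) c))
  CyclicConsecutive-functional u (wrap ws refl) (inner c) = ⊥-elim (Unique-∷ʳ⇒∉ (_ ∷ ws) u (Consecutive-∷ʳ (_ ∷ ws) c))
  CyclicConsecutive-functional u (wrap ws e) (wrap ws′ e′) = ∷-injectiveˡ (trans (sym e) e′)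

  CyclicConsecutive-rotate : ∀ {x y v vs} → CyclicConsecutive x y (v ∷ vs) → CyclicConsecutive x y (vs ++ [ v ])
  CyclicConsecutive-rotate (inner (here {zs})) = wrap zs refl
  CyclicConsecutive-rotate {v = v} (inner (there c)) = inner (Consecutive-++⁺ʳ [ v ] c)
  CyclicConsecutive-rotate {x} {y} (wrap ws refl) =
    inner (subst (Consecutive x y) (sym (++-assoc ws [ x ] [ y ])) (Consecutive-++⁺ˡ ws here))

  Unique-rotate : ∀ {v : A} {vs} → Unique (v ∷ vs) → Unique (vs ++ [ v ])
  Unique-rotate {v} {vs} u@(_ ∷ uvs) = ++⁺ uvs ([] ∷ []) λ { (w∈vs , here refl) → Unique[x∷xs]⇒x∉xs u w∈vs }

  Rotation-transport : (P : List A → Set) → (∀ {v vs} → P (v ∷ vs) → P (vs ++ [ v ])) →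
                       ∀ {xs ys} → Rotation xs ys → P xs → P ys
  Rotation-transport P step (p , r , refl , refl) = go p r
    where
    go : ∀ p r → P (p ++ r) → P (r ++ p)
    go [] r Pr = subst P (sym (++-identityʳ r)) Pr
    go (v ∷ p) r Pvpr = subst P (++-assoc r [ v ] p) (go p (r ++ [ v ]) (subst P (++-assoc p r [ v ]) (step Pvpr)))

  rotation₁ : ∀ x xs → Rotation (x ∷ xs) (xs ++ [ x ])
  rotation₁ x xs = [ x ] , xs , refl , refl

  Rotation-sym : ∀ {xs ys} → Rotation xs ys → Rotation ys xs
  Rotation-sym (p , r , xs≡ , ys≡) = r , p , ys≡ , xs≡

  Rotation-trans : ∀ {xs ys zs} → Rotation xs ys → Rotation ys zs → Rotation xs zs
  Rotation-trans {xs} ρ σ = Rotation-transport (Rotation xs) step σ ρ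
    where
    step : ∀ {v vs} → Rotation xs (v ∷ vs) → Rotation xs (vs ++ [ v ])
    step {v} {vs} (p , [] , refl , refl) = [ v ] , vs , ++-identityʳ p , refl
    step {v} {vs} (p , .v ∷ r , refl , refl) = p ++ [ v ] , r , sym (++-assoc p [ v ] r) , ++-assoc r p [ v ]

  Rotation-⊆ : ∀ {xs ys} → Rotation xs ys → xs ⊆ ys
  Rotation-⊆ (p , r , refl , refl) w∈pr with ∈-++⁻ p w∈pr
  ... | inj₁ w∈p = ∈-++⁺ʳ r w∈p
  ... | inj₂ w∈r = ∈-++⁺ˡ w∈r

  ∈-rotate₁ : ∀ {v x : A} {xs} → v ∈ x ∷ xs → v ∈ xs ++ [ x ]
  ∈-rotate₁ {x = x} {xs} = Rotation-⊆ (rotation₁ x xs)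

  ∈-unrotate₁ : ∀ {v x : A} {xs} → v ∈ xs ++ [ x ] → v ∈ x ∷ xs
  ∈-unrotate₁ {xs = xs} v∈ with ∈-++⁻ xs v∈
  ... | inj₁ v∈xs = there v∈xs
  ... | inj₂ (here refl) = here refl

  Rotation-length : ∀ {xs ys} → Rotation xs ys → length xs ≡ length ys
  Rotation-length (p , r , refl , refl) =
    trans (length-++ p) (trans (+-comm (length p) (length r)) (sym (length-++ r)))

  Rotation-countᵇ : ∀ f {xs ys} → Rotation xs ys → countᵇ f xs ≡ countᵇ f ys
  Rotation-countᵇ f (p , r , refl , refl) =
    trans (countᵇ-++ f p r) (trans (+-comm (countᵇ f p) (countᵇ f r)) (sym (countᵇ-++ f r p)))

  Rotation-Unique : ∀ {xs ys} → Rotation xs ys → Unique xs → Unique ys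
  Rotation-Unique = Rotation-transport Unique Unique-rotate

  Rotation-CyclicConsecutive : ∀ {x y xs ys} → Rotation xs ys → CyclicConsecutive x y xs → CyclicConsecutive x y ys
  Rotation-CyclicConsecutive {x} {y} = Rotation-transport (CyclicConsecutive x y) CyclicConsecutive-rotate

  Rotation-CycleEdge : ∀ {x y xs ys} → Rotation xs ys → CycleEdge x y xs → CycleEdge x y ys
  Rotation-CycleEdge ρ (inj₁ c) = inj₁ (Rotation-CyclicConsecutive ρ c)
  Rotation-CycleEdge ρ (inj₂ c) = inj₂ (Rotation-CyclicConsecutive ρ c)

  CycleEdge-sym : ∀ {x y zs} → CycleEdge x y zs → CycleEdge y x zs
  CycleEdge-sym (inj₁ c) = inj₂ c
  CycleEdge-sym (inj₂ c) = inj₁ c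

  rotate-to-∈ : ∀ {x zs} → x ∈ zs → ∃ λ rest → Rotation zs (x ∷ rest)
  rotate-to-∈ {x} x∈zs with p , r , refl ← ∈-∃++ x∈zs = r ++ p , p , x ∷ r , refl , refl

  rotate-to-CyclicConsecutive : ∀ {x y zs} → CyclicConsecutive x y zs → ∃ λ rest → Rotation zs (x ∷ y ∷ rest)
  rotate-to-CyclicConsecutive (inner c) with ws , vs , refl ← Consecutive-split c = vs ++ ws , ws , _ ∷ _ ∷ vs , refl , refl
  rotate-to-CyclicConsecutive (wrap ws refl) = ws , _ ∷ ws , [ _ ] , refl , refl

  cyclic-neighbours : ∀ {x zs} → x ∈ zs → Unique zs → 3 ≤ length zs →
                      ∃₂ λ w y → CyclicConsecutive w x zs × CyclicConsecutive x y zs × w ≢ y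
  cyclic-neighbours x∈zs u 3≤ with rotate-to-∈ x∈zs
  ... | [] , ρ with () ← ≤-pred (subst (3 ≤_) (Rotation-length ρ) 3≤)
  ... | y ∷ rest , ρ with initLast rest
  ...   | [] with () ← ≤-pred (≤-pred (subst (3 ≤_) (Rotation-length ρ) 3≤))
  ...   | ws ∷ʳ′ w = w , y , Rotation-CyclicConsecutive ρ˘ (wrap (y ∷ ws) refl) ,
                     Rotation-CyclicConsecutive ρ˘ (inner here) , w≢y
    where
    ρ˘ = Rotation-sym ρ
    w≢y : w ≢ y
    w≢y refl with _ ∷ y∉ws∷ʳy ← Rotation-Unique ρ u = Unique[x∷xs]⇒x∉xs y∉ws∷ʳy (∈-++⁺ʳ ws (here refl))

  CyclicConsecutive-4 : ∀ {c d a₁ a₂ a₃ a₄} → CyclicConsecutive c d (a₁ ∷ a₂ ∷ a₃ ∷ a₄ ∷ []) →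
    (c ≡ a₁ × d ≡ a₂) ⊎ (c ≡ a₂ × d ≡ a₃) ⊎ (c ≡ a₃ × d ≡ a₄) ⊎ (c ≡ a₄ × d ≡ a₁)
  CyclicConsecutive-4 (inner here) = inj₁ (refl , refl)
  CyclicConsecutive-4 (inner (there here)) = inj₂ (inj₁ (refl , refl))
  CyclicConsecutive-4 (inner (there (there here))) = inj₂ (inj₂ (inj₁ (refl , refl)))
  CyclicConsecutive-4 (inner (there (there (there (there ())))))
  CyclicConsecutive-4 (wrap (_ ∷ _ ∷ []) refl) = inj₂ (inj₂ (inj₂ (refl , refl)))
  CyclicConsecutive-4 (wrap (_ ∷ _ ∷ _ ∷ _ ∷ _) ())

  CyclicConsecutive-splice⁻ : ∀ {c d a x y b rest} → CyclicConsecutive c d (a ∷ x ∷ y ∷ b ∷ rest) →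
    (c ≡ a × d ≡ x) ⊎ (c ≡ x × d ≡ y) ⊎ (c ≡ y × d ≡ b) ⊎ CyclicConsecutive c d (a ∷ b ∷ rest)
  CyclicConsecutive-splice⁻ (inner here) = inj₁ (refl , refl)
  CyclicConsecutive-splice⁻ (inner (there here)) = inj₂ (inj₁ (refl , refl))
  CyclicConsecutive-splice⁻ (inner (there (there here))) = inj₂ (inj₂ (inj₁ (refl , refl)))
  CyclicConsecutive-splice⁻ (inner (there (there (there c)))) = inj₂ (inj₂ (inj₂ (inner (there c))))
  CyclicConsecutive-splice⁻ (wrap [] ())
  CyclicConsecutive-splice⁻ (wrap (_ ∷ []) ())
  CyclicConsecutive-splice⁻ (wrap (_ ∷ _ ∷ ws) e) =
    inj₂ (inj₂ (inj₂ (wrap ws (cong₂ _∷_ (∷-injectiveˡ e) (∷-injectiveʳ (∷-injectiveʳ (∷-injectiveʳ e)))))))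

  CyclicConsecutive-splice⁺ : ∀ {c d p q x y rest} → CyclicConsecutive c d (p ∷ q ∷ rest) → ¬ (c ≡ p × d ≡ q) →
                              CyclicConsecutive c d (p ∷ x ∷ y ∷ q ∷ rest)
  CyclicConsecutive-splice⁺ (inner here) ≢pq = ⊥-elim (≢pq (refl , refl))
  CyclicConsecutive-splice⁺ (inner (there c)) _ = inner (there (there (there c)))
  CyclicConsecutive-splice⁺ {x = x} {y} (wrap ws e) _ =
    wrap (x ∷ y ∷ ws) (cong₂ (λ h ws′ → h ∷ x ∷ y ∷ ws′) (∷-injectiveˡ e) (∷-injectiveʳ e))

  ∈-splice⁻ : ∀ {v a b x y : A} {ys} xs → v ∈ xs ++ a ∷ x ∷ y ∷ b ∷ ys →
              v ≡ x ⊎ v ≡ y ⊎ v ∈ xs ++ a ∷ b ∷ ys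
  ∈-splice⁻ [] (here v≡a) = inj₂ (inj₂ (here v≡a))
  ∈-splice⁻ [] (there (here v≡x)) = inj₁ v≡x
  ∈-splice⁻ [] (there (there (here v≡y))) = inj₂ (inj₁ v≡y)
  ∈-splice⁻ [] (there (there (there v∈))) = inj₂ (inj₂ (there v∈))
  ∈-splice⁻ (w ∷ xs) (here v≡w) = inj₂ (inj₂ (here v≡w))
  ∈-splice⁻ (w ∷ xs) (there v∈) with ∈-splice⁻ xs v∈
  ... | inj₁ v≡x = inj₁ v≡x
  ... | inj₂ (inj₁ v≡y) = inj₂ (inj₁ v≡y)
  ... | inj₂ (inj₂ v∈′) = inj₂ (inj₂ (there v∈′))

  ∈-splice⁺ : ∀ {v a b x y : A} {ys} xs → v ∈ xs ++ a ∷ b ∷ ys → v ∈ xs ++ a ∷ x ∷ y ∷ b ∷ ys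
  ∈-splice⁺ [] (here v≡a) = here v≡a
  ∈-splice⁺ [] (there (here v≡b)) = there (there (there (here v≡b)))
  ∈-splice⁺ [] (there (there v∈)) = there (there (there (there v∈)))
  ∈-splice⁺ (w ∷ xs) (here v≡w) = here v≡w
  ∈-splice⁺ (w ∷ xs) (there v∈) = there (∈-splice⁺ xs v∈)

  length-splice : ∀ {a b x y : A} {ys} xs → length (xs ++ a ∷ x ∷ y ∷ b ∷ ys) ≡ 2 + length (xs ++ a ∷ b ∷ ys)
  length-splice [] = refl
  length-splice (w ∷ xs) = cong suc (length-splice xs)

  Consecutive-splice⁺ : ∀ {c d a b x y : A} {ys} xs → Consecutive c d (xs ++ a ∷ b ∷ ys) →
                        (c ≡ a × d ≡ b) ⊎ Consecutive c d (xs ++ a ∷ x ∷ y ∷ b ∷ ys)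
  Consecutive-splice⁺ [] here = inj₁ (refl , refl)
  Consecutive-splice⁺ [] (there c) = inj₂ (there (there (there c)))
  Consecutive-splice⁺ (w ∷ []) here = inj₂ here
  Consecutive-splice⁺ (w ∷ _ ∷ xs) here = inj₂ here
  Consecutive-splice⁺ (w ∷ xs) (there c) = Sum.map₂ there (Consecutive-splice⁺ xs c)

  splice-∷ʳ : ∀ {a b x y l : A} {ys} xs ws → xs ++ a ∷ b ∷ ys ≡ ws ++ [ l ] →
              ∃ λ ws′ → xs ++ a ∷ x ∷ y ∷ b ∷ ys ≡ ws′ ++ [ l ]
  splice-∷ʳ [] [] ()
  splice-∷ʳ {a} {x = x} {y} [] (w ∷ ws) e = a ∷ x ∷ y ∷ ws , cong (λ ws′ → a ∷ x ∷ y ∷ ws′) (∷-injectiveʳ e)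
  splice-∷ʳ (f ∷ []) [] ()
  splice-∷ʳ (f ∷ _ ∷ xs) [] ()
  splice-∷ʳ (f ∷ xs) (w ∷ ws) e with ws′ , e′ ← splice-∷ʳ xs ws (∷-injectiveʳ e) = f ∷ ws′ , cong (f ∷_) e′

  splice-∷-∷ʳ : ∀ {a b x y h l : A} {ys} xs ws → xs ++ a ∷ b ∷ ys ≡ h ∷ ws ++ [ l ] →
                ∃ λ ws′ → xs ++ a ∷ x ∷ y ∷ b ∷ ys ≡ h ∷ ws′ ++ [ l ]
  splice-∷-∷ʳ {x = x} {y} [] ws e =
    x ∷ y ∷ ws , cong₂ (λ h ws′ → h ∷ x ∷ y ∷ ws′) (∷-injectiveˡ e) (∷-injectiveʳ e)
  splice-∷-∷ʳ (f ∷ xs) ws e with ws′ , e′ ← splice-∷ʳ xs ws (∷-injectiveʳ e) =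
    ws′ , cong₂ _∷_ (∷-injectiveˡ e) e′

  CyclicConsecutive-cut : ∀ {c d a b rest} → CyclicConsecutive c d (a ∷ b ∷ rest) →
                          (c ≡ a × d ≡ b) ⊎ Consecutive c d (b ∷ rest ++ [ a ])
  CyclicConsecutive-cut (inner here) = inj₁ (refl , refl)
  CyclicConsecutive-cut {a = a} (inner (there c)) = inj₂ (Consecutive-++⁺ʳ [ a ] c)
  CyclicConsecutive-cut {c} {d} (wrap ws e) with refl ← ∷-injectiveˡ e =
    inj₂ (subst (Consecutive c d) (sym (trans (cong (_++ [ d ]) (∷-injectiveʳ e)) (++-assoc ws [ c ] [ d ])))
                (Consecutive-++⁺ˡ ws here))

  spliced-¬edge : ∀ {a x y b rest} → Unique (a ∷ x ∷ y ∷ b ∷ rest) → x ∉ a ∷ b ∷ rest →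
                  ¬ CyclicConsecutive a b (a ∷ x ∷ y ∷ b ∷ rest)
  spliced-¬edge u x∉ ab = x∉ (there (here (CyclicConsecutive-functional u (inner here) ab)))

  CyclicConsecutive-splice : ∀ {c d a x y b rest} → CyclicConsecutive c d (a ∷ x ∷ y ∷ b ∷ rest) →
    (c ∈ a ∷ x ∷ y ∷ b ∷ [] × d ∈ a ∷ x ∷ y ∷ b ∷ []) ⊎ (c ∈ a ∷ b ∷ rest × d ∈ a ∷ b ∷ rest)
  CyclicConsecutive-splice cd with CyclicConsecutive-splice⁻ cd
  ... | inj₁ (refl , refl) = inj₁ (here refl , there (here refl))
  ... | inj₂ (inj₁ (refl , refl)) = inj₁ (there (here refl) , there (there (here refl)))
  ... | inj₂ (inj₂ (inj₁ (refl , refl))) = inj₁ (there (there (here refl)) , there (there (there (here refl))))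
  ... | inj₂ (inj₂ (inj₂ cd′)) = inj₂ (CyclicConsecutive⇒∈ˡ cd′ , CyclicConsecutive⇒∈ʳ cd′)

  CycleEdge-splice : ∀ {c d a x y b rest} → CycleEdge c d (a ∷ x ∷ y ∷ b ∷ rest) →
    (c ∈ a ∷ x ∷ y ∷ b ∷ [] × d ∈ a ∷ x ∷ y ∷ b ∷ []) ⊎ (c ∈ a ∷ b ∷ rest × d ∈ a ∷ b ∷ rest)
  CycleEdge-splice (inj₁ cd) = CyclicConsecutive-splice cd
  CycleEdge-splice (inj₂ dc) = Sum.map swap swap (CyclicConsecutive-splice dc)

  CycleEdge-touching : ∀ {c d w a x y b rest} → CycleEdge c d (a ∷ x ∷ y ∷ b ∷ rest) → w ∉ a ∷ b ∷ rest →
                       w ∈ c ∷ d ∷ [] → c ∈ a ∷ x ∷ y ∷ b ∷ [] × d ∈ a ∷ x ∷ y ∷ b ∷ []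
  CycleEdge-touching cd w∉ w∈cd with CycleEdge-splice cd | w∈cd
  ... | inj₁ ends | _ = ends
  ... | inj₂ (c∈ , _) | here refl = ⊥-elim (w∉ c∈)
  ... | inj₂ (_ , d∈) | there (here refl) = ⊥-elim (w∉ d∈)

-- Tetragonal graphs

module _ {n : ℕ} where

  boundary-Unique : ∀ {E B} → Tet {n} E B → Unique B
  boundary-Unique (c4 a b c d a≢b a≢c a≢d b≢c b≢d c≢d) =
    (a≢b ∷ a≢c ∷ a≢d ∷ []) ∷ (b≢c ∷ b≢d ∷ []) ∷ (c≢d ∷ []) ∷ [] ∷ []
  boundary-Unique (rot T) = Unique-rotate (boundary-Unique T)
  boundary-Unique (ext x y T x∉ y∉ x≢y) with (a≢b ∷ a≢rest) ∷ u ← boundary-Unique T =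
    (a≢x ∷ a≢y ∷ a≢b ∷ a≢rest) ∷ (x≢y ∷ ¬Any⇒All¬ _ (x∉ ∘ there)) ∷ ¬Any⇒All¬ _ (y∉ ∘ there) ∷ u
    where
    a≢x = λ a≡x → x∉ (here (sym a≡x))
    a≢y = λ a≡y → y∉ (here (sym a≡y))

  boundary-length : ∀ {E B} → Tet {n} E B → 4 ≤ length B
  boundary-length (c4 _ _ _ _ _ _ _ _ _ _) = ≤-refl
  boundary-length (rot {v = v} {vs} T) = subst (4 ≤_) (Rotation-length ([ v ] , vs , refl , refl)) (boundary-length T)
  boundary-length (ext x y T _ _ _) = ≤-trans (boundary-length T) (≤-trans (n≤1+n _) (n≤1+n _))

  boundary-edge : ∀ {E B c d} → Tet {n} E B → CyclicConsecutive c d B → (c , d) ∈ E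
  boundary-edge (c4 _ _ _ _ _ _ _ _ _ _) cd with CyclicConsecutive-4 cd
  ... | inj₁ (refl , refl) = here refl
  ... | inj₂ (inj₁ (refl , refl)) = there (here refl)
  ... | inj₂ (inj₂ (inj₁ (refl , refl))) = there (there (here refl))
  ... | inj₂ (inj₂ (inj₂ (refl , refl))) = there (there (there (here refl)))
  boundary-edge (rot {v = v} {vs} T) cd = boundary-edge T (Rotation-CyclicConsecutive (vs , [ v ] , refl , refl) cd)
  boundary-edge (ext x y T _ _ _) cd with CyclicConsecutive-splice⁻ cd
  ... | inj₁ (refl , refl) = here refl
  ... | inj₂ (inj₁ (refl , refl)) = there (here refl)
  ... | inj₂ (inj₂ (inj₁ (refl , refl))) = there (there (here refl))
  ... | inj₂ (inj₂ (inj₂ cd′)) = there (there (there (boundary-edge T cd′)))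

  Rotation-Tet : ∀ {E B B′} → Rotation B B′ → Tet {n} E B → Tet E B′
  Rotation-Tet {E} = Rotation-transport (Tet E) rot

  -- the boundary a′ b′ ⋯ with the ear a x y b spliced into its edge a b, again listed from a′ b′
  record Splice (E : List (Fin n × Fin n)) (a′ b′ : Fin n) (rest′ : List (Fin n)) (a x y b : Fin n) : Set where
    field
      rest : List (Fin n)
      tet : Tet ((a , x) ∷ (x , y) ∷ (y , b) ∷ E) (a′ ∷ b′ ∷ rest)
      ⊆rest : a′ ∷ b′ ∷ rest′ ⊆ a′ ∷ b′ ∷ rest
      x∈ : x ∈ a′ ∷ b′ ∷ rest
      y∈ : y ∈ a′ ∷ b′ ∷ rest
      rest⊆ : ∀ {v} → v ∈ a′ ∷ b′ ∷ rest → v ≡ x ⊎ v ≡ y ⊎ v ∈ a′ ∷ b′ ∷ rest′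
      length≡ : length (a′ ∷ b′ ∷ rest) ≡ 2 + length (a′ ∷ b′ ∷ rest′)
      ear : ∀ {c d} → (c ≡ a × d ≡ x) ⊎ (c ≡ x × d ≡ y) ⊎ (c ≡ y × d ≡ b) →
            Consecutive c d (b′ ∷ rest ++ [ a′ ])
      keeps : ∀ {c d} → Consecutive c d (b′ ∷ rest′ ++ [ a′ ]) →
              (c ≡ a × d ≡ b) ⊎ Consecutive c d (b′ ∷ rest ++ [ a′ ])

  Tet-splice : ∀ {E a′ b′ rest′ a b x y} → Tet {n} E (a′ ∷ b′ ∷ rest′) →
               Consecutive a b (b′ ∷ rest′ ++ [ a′ ]) →
               x ∉ a′ ∷ b′ ∷ rest′ → y ∉ a′ ∷ b′ ∷ rest′ → x ≢ y → Splice E a′ b′ rest′ a x y b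
  Tet-splice {E} {a′} {b′} {rest′} {a} {b} {x} {y} T ab x∉ y∉ x≢y
    with xs , ys , split ← Consecutive-split ab
    with M , split′ ← splice-∷-∷ʳ {x = x} {y} xs rest′ (sym split) = record
    { rest = M
    ; tet = Rotation-Tet (Rotation-sym (rotation₁ a′ (b′ ∷ M))) (subst (Tet _) split′ T′)
    ; ⊆rest = λ {v} v∈ → ∈-unrotate₁ (subst (v ∈_) split′ (∈-splice⁺ xs (subst (v ∈_) split (∈-rotate₁ v∈))))
    ; x∈ = ∈-unrotate₁ (subst (x ∈_) split′ (∈-++⁺ʳ xs (there (here refl))))
    ; y∈ = ∈-unrotate₁ (subst (y ∈_) split′ (∈-++⁺ʳ xs (there (there (here refl)))))
    ; rest⊆ = λ {v} v∈ → Sum.map₂ (Sum.map₂ (∈-unrotate₁ ∘ subst (v ∈_) (sym split)))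
                                 (∈-splice⁻ xs (subst (v ∈_) (sym split′) (∈-rotate₁ v∈)))
    ; length≡ = begin
        length (a′ ∷ b′ ∷ M)                ≡⟨ Rotation-length (rotation₁ a′ (b′ ∷ M)) ⟩
        length (b′ ∷ M ++ [ a′ ])           ≡⟨ cong length split′ ⟨
        length (xs ++ a ∷ x ∷ y ∷ b ∷ ys)   ≡⟨ length-splice xs ⟩
        2 + length (xs ++ a ∷ b ∷ ys)       ≡⟨ cong (λ zs → 2 + length zs) split ⟨
        2 + length (b′ ∷ rest′ ++ [ a′ ])   ≡⟨ cong (2 +_) (Rotation-length (rotation₁ a′ (b′ ∷ rest′))) ⟨
        2 + length (a′ ∷ b′ ∷ rest′)        ∎
    ; ear = λ { (inj₁ (refl , refl)) → subst (Consecutive _ _) split′ (Consecutive-++⁺ˡ xs here)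
              ; (inj₂ (inj₁ (refl , refl))) → subst (Consecutive _ _) split′ (Consecutive-++⁺ˡ xs (there here))
              ; (inj₂ (inj₂ (refl , refl))) → subst (Consecutive _ _) split′ (Consecutive-++⁺ˡ xs (there (there here))) }
    ; keeps = λ cd → Sum.map₂ (subst (Consecutive _ _) split′) (Consecutive-splice⁺ xs (subst (Consecutive _ _) split cd)) }
    where
    open ≡-Reasoning
    ρ : Rotation (xs ++ a ∷ b ∷ ys) (a ∷ b ∷ ys ++ xs)
    ρ = xs , a ∷ b ∷ ys , refl , refl
    fresh : ∀ {v} → v ∉ a′ ∷ b′ ∷ rest′ → v ∉ a ∷ b ∷ ys ++ xs
    fresh {v} v∉ = v∉ ∘ ∈-unrotate₁ ∘ subst (v ∈_) (sym split) ∘ Rotation-⊆ (Rotation-sym ρ)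
    T′ : Tet ((a , x) ∷ (x , y) ∷ (y , b) ∷ E) (xs ++ a ∷ x ∷ y ∷ b ∷ ys)
    T′ = Rotation-Tet (a ∷ x ∷ y ∷ b ∷ ys , xs , refl , refl)
           (ext x y (Rotation-Tet ρ (subst (Tet E) split (rot T))) (fresh x∉) (fresh y∉) x≢y)

-- Tetragonal subgraphs of a bipartite graph

module Bipartite (G : BipartiteGraph) where
  open BipartiteGraph G public using (n; adj; side; proper; irrefl) renaming (sym to adj-comm)
  open import Data.List.Membership.DecPropositional (_≟_ {n = n}) using (_∈?_)

  V : Set
  V = Fin n

  Adj : V → V → Set
  Adj u v = adj u v ≡ true

  Adj-sym : ∀ {u v} → Adj u v → Adj v u
  Adj-sym {u} {v} u~v = trans (adj-comm v u) u~v

  Linked : List V → Set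
  Linked L = ∀ {x y} → Consecutive x y L → Adj x y

  boundary-Adj : ∀ {E B c d} → Tet E B → SubgraphOf G E → CyclicConsecutive c d B → Adj c d
  boundary-Adj T E⊆G cd = E⊆G (boundary-edge T cd)

  boundary-Linked : ∀ {E B} → Tet E B → SubgraphOf G E → Linked B
  boundary-Linked T E⊆G cd = boundary-Adj T E⊆G (inner cd)

  Adj⇒side : ∀ {x y} → Adj x y → side y ≡ not (side x)
  Adj⇒side {x} {y} x~y with side x | side y | proper x y x~y
  ... | true | false | _ = refl
  ... | false | true | _ = refl
  ... | true | true | ≢ = ⊥-elim (≢ refl)
  ... | false | false | ≢ = ⊥-elim (≢ refl)

  opposite : V → V → Bool
  opposite u c = side u xor side c

  opposite-self : ∀ u → opposite u u ≡ false
  opposite-self u = xor-same (side u)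

  opposite-step : ∀ u {x y} → Adj x y → opposite u y ≡ not (opposite u x)
  opposite-step u {x} x~y = trans (cong (side u xor_) (Adj⇒side x~y)) (sym (not-distribʳ-xor (side u) (side x)))

  opposite-step² : ∀ u {x y z} → Adj x y → Adj y z → opposite u z ≡ opposite u x
  opposite-step² u x~y y~z = trans (opposite-step u y~z) (trans (cong not (opposite-step u x~y)) (not-involutive _))

  Adj⇒opposite : ∀ {u c} → Adj u c → opposite u c ≡ true
  Adj⇒opposite {u} u~c = trans (opposite-step u u~c) (cong not (opposite-self u))

  opposite-across : ∀ u {x y} → Adj x y → opposite u y ≡ true → opposite u x ≡ false
  opposite-across u x~y opp-y = not-injective (trans (sym (opposite-step u x~y)) opp-y)

  common-neighbour⇒same-side : ∀ {v r₁ r₂} → Adj v r₁ → Adj v r₂ → side r₁ ≡ side r₂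
  common-neighbour⇒same-side v~r₁ v~r₂ = trans (Adj⇒side v~r₁) (sym (Adj⇒side v~r₂))

  ¬opposite⇒¬Adj : ∀ {u c} → opposite u c ≡ false → adj u c ≡ false
  ¬opposite⇒¬Adj {u} {c} ¬opp with adj u c in u~c
  ... | false = refl
  ... | true with () ← trans (sym (Adj⇒opposite u~c)) ¬opp

  opposite-≡⇒¬Adj : ∀ u {x y} → opposite u x ≡ opposite u y → adj x y ≡ false
  opposite-≡⇒¬Adj u {x} {y} same with adj x y in x~y
  ... | false = refl
  ... | true = ⊥-elim (not-¬ refl (trans same (opposite-step u x~y)))

  ¬opposite⇒same-side : ∀ {u c} → opposite u c ≡ false → side c ≡ side u
  ¬opposite⇒same-side {u} {c} ¬opp with side u | side c
  ... | true | true = refl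
  ... | false | false = refl
  ... | true | false with () ← ¬opp
  ... | false | true with () ← ¬opp

  opposite-flip : ∀ {u w} → side u ≢ side w → ∀ c → opposite w c ≡ not (opposite u c)
  opposite-flip {u} {w} su≢sw c with side u | side w
  ... | true | false = sym (not-involutive (side c))
  ... | false | true = refl
  ... | true | true = ⊥-elim (su≢sw refl)
  ... | false | false = ⊥-elim (su≢sw refl)

  Alternating : (V → Bool) → Set
  Alternating f = ∀ {x y} → Adj x y → f y ≡ not (f x)

  Linked-balanced : ∀ {f} → Alternating f → ∀ k L → Linked L → length L ≡ k + k → countᵇ f L ≡ k
  Linked-balanced alt zero [] _ _ = refl
  Linked-balanced {f} alt (suc k) (x ∷ y ∷ L) linked len with f x | f y | alt (linked here)
  ... | true | false | _ = cong suc (Linked-balanced alt k L (λ c → linked (there (there c))) (double-pred len))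
  ... | false | true | _ = cong suc (Linked-balanced alt k L (λ c → linked (there (there c))) (double-pred len))
  ... | true | true | ()
  ... | false | false | ()
  Linked-balanced alt (suc k) (x ∷ []) _ len with () ← trans (suc-injective len) (+-suc k k)

  SubgraphOf-ear : ∀ {E a x y b} → SubgraphOf G E → Adj a x → Adj x y → Adj y b →
                   SubgraphOf G ((a , x) ∷ (x , y) ∷ (y , b) ∷ E)
  SubgraphOf-ear E⊆G a~x x~y y~b (here refl) = a~x
  SubgraphOf-ear E⊆G a~x x~y y~b (there (here refl)) = x~y
  SubgraphOf-ear E⊆G a~x x~y y~b (there (there (here refl))) = y~b
  SubgraphOf-ear E⊆G a~x x~y y~b (there (there (there e∈E))) = E⊆G e∈E

  record EarExtension (L : List V) (p x y q : V) : Set where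
    field
      E′ : List (V × V)
      L′ : List V
      tet : Tet E′ L′
      E′⊆G : SubgraphOf G E′
      length≡ : length L′ ≡ 2 + length L
      ⊆L′ : L ⊆ L′
      x∈L′ : x ∈ L′
      y∈L′ : y ∈ L′
      L′⊆ : ∀ {v} → v ∈ L′ → v ≡ x ⊎ v ≡ y ⊎ v ∈ L
      p-x : CycleEdge p x L′
      x-y : CycleEdge x y L′
      y-q : CycleEdge y q L′
      keeps : ∀ {c d} → CyclicConsecutive c d L → ¬ (c ≡ p × d ≡ q) → ¬ (c ≡ q × d ≡ p) →
              CyclicConsecutive c d L′

  EarExtension-∉ : ∀ {L p x y q w} (X : EarExtension L p x y q) → w ∉ L → w ≢ x → w ≢ y → w ∉ EarExtension.L′ X
  EarExtension-∉ X w∉L w≢x w≢y w∈ with EarExtension.L′⊆ X w∈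
  ... | inj₁ w≡x = w≢x w≡x
  ... | inj₂ (inj₁ w≡y) = w≢y w≡y
  ... | inj₂ (inj₂ w∈L) = w∉L w∈L

  EarExtension-keeps-edge : ∀ {L p x y q c d} (X : EarExtension L p x y q) → CycleEdge c d L → c ≢ q → d ≢ q →
                            CycleEdge c d (EarExtension.L′ X)
  EarExtension-keeps-edge X (inj₁ cd) c≢q d≢q = inj₁ (EarExtension.keeps X cd (d≢q ∘ proj₂) (c≢q ∘ proj₁))
  EarExtension-keeps-edge X (inj₂ dc) c≢q d≢q = inj₂ (EarExtension.keeps X dc (c≢q ∘ proj₂) (d≢q ∘ proj₁))

  EarExtension-reverse : ∀ {L p x y q} → EarExtension L q y x p → EarExtension L p x y q
  EarExtension-reverse X = record
    { E′ = E′ ; L′ = L′ ; tet = tet ; E′⊆G = E′⊆G ; length≡ = length≡ ; ⊆L′ = ⊆L′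
    ; x∈L′ = y∈L′ ; y∈L′ = x∈L′
    ; L′⊆ = λ v∈ → [ inj₂ ∘ inj₁ , [ inj₁ , inj₂ ∘ inj₂ ]′ ]′ (L′⊆ v∈)
    ; p-x = CycleEdge-sym y-q ; x-y = CycleEdge-sym x-y ; y-q = CycleEdge-sym p-x
    ; keeps = λ cd ≢pq ≢qp → keeps cd ≢qp ≢pq }
    where open EarExtension X

  attachEar→ : ∀ {E L p q x y} → Tet E L → SubgraphOf G E → CyclicConsecutive p q L →
               x ∉ L → y ∉ L → x ≢ y → Adj p x → Adj x y → Adj y q → EarExtension L p x y q
  attachEar→ {p = p} {q} {x} {y} T E⊆G pq x∉ y∉ x≢y p~x x~y y~q
    with rest , ρ ← rotate-to-CyclicConsecutive pq = record
    { L′ = p ∷ x ∷ y ∷ q ∷ rest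
    ; tet = ext x y (Rotation-Tet ρ T) (x∉ ∘ ρ˘⊆) (y∉ ∘ ρ˘⊆) x≢y
    ; E′⊆G = SubgraphOf-ear E⊆G p~x x~y y~q
    ; length≡ = cong (2 +_) (sym (Rotation-length ρ))
    ; ⊆L′ = ∈-splice⁺ [] ∘ Rotation-⊆ ρ
    ; x∈L′ = there (here refl)
    ; y∈L′ = there (there (here refl))
    ; L′⊆ = λ v∈ → Sum.map₂ (Sum.map₂ ρ˘⊆) (∈-splice⁻ [] v∈)
    ; p-x = inj₁ (inner here)
    ; x-y = inj₁ (inner (there here))
    ; y-q = inj₁ (inner (there (there here)))
    ; keeps = λ cd ≢pq _ → CyclicConsecutive-splice⁺ (Rotation-CyclicConsecutive ρ cd) ≢pq }
    where ρ˘⊆ = Rotation-⊆ (Rotation-sym ρ)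

  attachEar : ∀ {E L p q x y} → Tet E L → SubgraphOf G E → CycleEdge p q L →
              x ∉ L → y ∉ L → x ≢ y → Adj p x → Adj x y → Adj y q → EarExtension L p x y q
  attachEar T E⊆G (inj₁ pq) x∉ y∉ x≢y p~x x~y y~q = attachEar→ T E⊆G pq x∉ y∉ x≢y p~x x~y y~q
  attachEar T E⊆G (inj₂ qp) x∉ y∉ x≢y p~x x~y y~q =
    EarExtension-reverse (attachEar→ T E⊆G qp y∉ x∉ (x≢y ∘ sym) (Adj-sym y~q) (Adj-sym x~y) (Adj-sym p~x))

  Optimal-longest : ∀ {E B E′ B′} → Optimal G E B → Tet E′ B′ → SubgraphOf G E′ → length B′ ≤ length B
  Optimal-longest {E′ = E′} {B′} opt T′ E′⊆G = proj₁ (proj₂ opt E′ B′ (T′ , E′⊆G))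

  Optimal-no-ear : ∀ {E B p q x y} → Optimal G E B → CycleEdge p q B →
                   x ∉ B → y ∉ B → x ≢ y → Adj p x → Adj x y → Adj y q → ⊥
  Optimal-no-ear {B = B} opt pq x∉ y∉ x≢y p~x x~y y~q =
    <⇒≱ (subst (length B <_) (sym length≡) (s≤s (n≤1+n _))) (Optimal-longest opt tet E′⊆G)
    where open EarExtension (attachEar (proj₁ (proj₁ opt)) (proj₂ (proj₁ opt)) pq x∉ y∉ x≢y p~x x~y y~q)

  -- B is the boundary of `base` (boundary a b ⋯) with the ear a s t b attached; the ear avoids z₁ and z₂
  record RemovableEar (B : List V) (z₁ z₂ : V) : Set where
    field
      a b s t : V
      rest : List V
      E₀ : List (V × V)
      base : Tet E₀ (a ∷ b ∷ rest)
      E₀⊆G : SubgraphOf G E₀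
      s∉ : s ∉ a ∷ b ∷ rest
      t∉ : t ∉ a ∷ b ∷ rest
      s≢t : s ≢ t
      a~s : Adj a s
      s~t : Adj s t
      t~b : Adj t b
      B⊆ : B ⊆ a ∷ s ∷ t ∷ b ∷ rest
      ⊆B : a ∷ s ∷ t ∷ b ∷ rest ⊆ B
      length≡ : length B ≡ 2 + length (a ∷ b ∷ rest)
      s≢z₁ : s ≢ z₁
      s≢z₂ : s ≢ z₂
      t≢z₁ : t ≢ z₁
      t≢z₂ : t ≢ z₂
      others : ∀ {c d} → CyclicConsecutive c d B → c ≢ s → c ≢ t → d ≢ s → d ≢ t →
               Consecutive c d (b ∷ rest ++ [ a ])

    Base : List V
    Base = a ∷ b ∷ rest

    Base⊆B : Base ⊆ B
    Base⊆B = ⊆B ∘ ∈-splice⁺ []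

    s∈B : s ∈ B
    s∈B = ⊆B (there (here refl))

    t∈B : t ∈ B
    t∈B = ⊆B (there (there (here refl)))

    a≢b : a ≢ b
    a≢b a≡b = Unique[x∷xs]⇒x∉xs (boundary-Unique base) (here a≡b)

  RemovableEar-rotate : ∀ {B B′ z₁ z₂} → Rotation B B′ → RemovableEar B z₁ z₂ → RemovableEar B′ z₁ z₂
  RemovableEar-rotate ρ R = record
    { a = a ; b = b ; s = s ; t = t ; rest = rest ; E₀ = E₀ ; base = base ; E₀⊆G = E₀⊆G
    ; s∉ = s∉ ; t∉ = t∉ ; s≢t = s≢t ; a~s = a~s ; s~t = s~t ; t~b = t~b
    ; s≢z₁ = s≢z₁ ; s≢z₂ = s≢z₂ ; t≢z₁ = t≢z₁ ; t≢z₂ = t≢z₂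
    ; B⊆ = B⊆ ∘ Rotation-⊆ (Rotation-sym ρ)
    ; ⊆B = Rotation-⊆ ρ ∘ ⊆B
    ; length≡ = trans (sym (Rotation-length ρ)) length≡
    ; others = others ∘ Rotation-CyclicConsecutive (Rotation-sym ρ) }
    where open RemovableEar R

  lastEar : ∀ {E₀ a b x y z₁ z₂ rest} → Tet E₀ (a ∷ b ∷ rest) →
              SubgraphOf G ((a , x) ∷ (x , y) ∷ (y , b) ∷ E₀) → x ∉ a ∷ b ∷ rest → y ∉ a ∷ b ∷ rest → x ≢ y →
              x ∉ z₁ ∷ z₂ ∷ [] → y ∉ z₁ ∷ z₂ ∷ [] → RemovableEar (a ∷ x ∷ y ∷ b ∷ rest) z₁ z₂
  lastEar {E₀} {a} {b} {x} {y} {rest = rest} T E⊆G x∉ y∉ x≢y x∉z y∉z = record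
    { a = a ; b = b ; s = x ; t = y ; rest = rest ; E₀ = E₀ ; base = T
    ; E₀⊆G = λ e∈ → E⊆G (there (there (there e∈)))
    ; s∉ = x∉ ; t∉ = y∉ ; s≢t = x≢y
    ; a~s = E⊆G (here refl) ; s~t = E⊆G (there (here refl)) ; t~b = E⊆G (there (there (here refl)))
    ; B⊆ = λ v∈ → v∈ ; ⊆B = λ v∈ → v∈ ; length≡ = refl
    ; s≢z₁ = λ x≡z₁ → x∉z (here x≡z₁) ; s≢z₂ = λ x≡z₂ → x∉z (there (here x≡z₂))
    ; t≢z₁ = λ y≡z₁ → y∉z (here y≡z₁) ; t≢z₂ = λ y≡z₂ → y∉z (there (here y≡z₂))
    ; others = others }
    where
    others : ∀ {c d} → CyclicConsecutive c d (a ∷ x ∷ y ∷ b ∷ rest) → c ≢ x → c ≢ y → d ≢ x → d ≢ y →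
             Consecutive c d (b ∷ rest ++ [ a ])
    others cd c≢x c≢y d≢x d≢y with CyclicConsecutive-splice⁻ cd
    ... | inj₁ (refl , refl) = ⊥-elim (d≢x refl)
    ... | inj₂ (inj₁ (refl , refl)) = ⊥-elim (c≢x refl)
    ... | inj₂ (inj₂ (inj₁ (refl , refl))) = ⊥-elim (c≢y refl)
    ... | inj₂ (inj₂ (inj₂ cd′)) with CyclicConsecutive-cut cd′
    ...   | inj₁ (refl , refl) = ⊥-elim (spliced-¬edge (boundary-Unique (ext x y T x∉ y∉ x≢y)) x∉ cd)
    ...   | inj₂ c = c

  -- when T is the 4-cycle a b c d plus the ear a x y b, the removable ear is c d
  hexagonEar : ∀ {E₀ a b c d x y z₁ z₂} → Tet E₀ (a ∷ b ∷ c ∷ d ∷ []) → SubgraphOf G E₀ →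
               x ∉ a ∷ b ∷ c ∷ d ∷ [] → y ∉ a ∷ b ∷ c ∷ d ∷ [] → x ≢ y → Adj a x → Adj x y → Adj y b →
               z₁ ∈ a ∷ x ∷ y ∷ b ∷ [] → z₂ ∈ a ∷ x ∷ y ∷ b ∷ [] →
               RemovableEar (a ∷ x ∷ y ∷ b ∷ c ∷ d ∷ []) z₁ z₂
  hexagonEar {a = a} {b} {c} {d} {x} {y} {z₁} {z₂} T E⊆G x∉ y∉ x≢y a~x x~y y~b z₁∈ z₂∈ =
    hexagon (boundary-Unique (ext x y T x∉ y∉ x≢y))
    where
    hexagon : Unique (a ∷ x ∷ y ∷ b ∷ c ∷ d ∷ []) → RemovableEar (a ∷ x ∷ y ∷ b ∷ c ∷ d ∷ []) z₁ z₂
    hexagon u@((a≢x ∷ a≢y ∷ a≢b ∷ a≢c ∷ a≢d ∷ []) ∷ (_ ∷ x≢b ∷ x≢c ∷ x≢d ∷ [])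
               ∷ (y≢b ∷ y≢c ∷ y≢d ∷ [])
               ∷ (b≢c ∷ b≢d ∷ []) ∷ (c≢d ∷ []) ∷ [] ∷ []) = record
      { a = b ; b = a ; s = c ; t = d ; rest = x ∷ y ∷ [] ; E₀ = (b , a) ∷ (a , x) ∷ (x , y) ∷ (y , b) ∷ []
      ; base = c4 b a x y (a≢b ∘ sym) (x≢b ∘ sym) (y≢b ∘ sym) a≢x a≢y x≢y
      ; E₀⊆G = E₀⊆G
      ; s∉ = c∉ ; t∉ = d∉ ; s≢t = c≢d
      ; a~s = boundary-Adj T E⊆G (inner (there here))
      ; s~t = boundary-Adj T E⊆G (inner (there (there here)))
      ; t~b = boundary-Adj T E⊆G (wrap (b ∷ c ∷ []) refl)
      ; B⊆ = Rotation-⊆ ρ ; ⊆B = Rotation-⊆ (Rotation-sym ρ) ; length≡ = refl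
      ; s≢z₁ = λ { refl → c∉ (ear⊆ z₁∈) } ; s≢z₂ = λ { refl → c∉ (ear⊆ z₂∈) }
      ; t≢z₁ = λ { refl → d∉ (ear⊆ z₁∈) } ; t≢z₂ = λ { refl → d∉ (ear⊆ z₂∈) }
      ; others = others }
      where
      ρ : Rotation (a ∷ x ∷ y ∷ b ∷ c ∷ d ∷ []) (b ∷ c ∷ d ∷ a ∷ x ∷ y ∷ [])
      ρ = a ∷ x ∷ y ∷ [] , b ∷ c ∷ d ∷ [] , refl , refl
      ear⊆ : a ∷ x ∷ y ∷ b ∷ [] ⊆ b ∷ a ∷ x ∷ y ∷ []
      ear⊆ = Rotation-⊆ (a ∷ x ∷ y ∷ [] , [ b ] , refl , refl)
      c∉ : c ∉ b ∷ a ∷ x ∷ y ∷ []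
      c∉ = All¬⇒¬Any ((b≢c ∘ sym) ∷ (a≢c ∘ sym) ∷ (x≢c ∘ sym) ∷ (y≢c ∘ sym) ∷ [])
      d∉ : d ∉ b ∷ a ∷ x ∷ y ∷ []
      d∉ = All¬⇒¬Any ((b≢d ∘ sym) ∷ (a≢d ∘ sym) ∷ (x≢d ∘ sym) ∷ (y≢d ∘ sym) ∷ [])
      E₀⊆G : SubgraphOf G ((b , a) ∷ (a , x) ∷ (x , y) ∷ (y , b) ∷ [])
      E₀⊆G (here refl) = Adj-sym (boundary-Adj T E⊆G (inner here))
      E₀⊆G (there (here refl)) = a~x
      E₀⊆G (there (there (here refl))) = x~y
      E₀⊆G (there (there (there (here refl)))) = y~b
      others : ∀ {c′ d′} → CyclicConsecutive c′ d′ (a ∷ x ∷ y ∷ b ∷ c ∷ d ∷ []) →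
               c′ ≢ c → c′ ≢ d → d′ ≢ c → d′ ≢ d → Consecutive c′ d′ (a ∷ x ∷ y ∷ b ∷ [])
      others cd c′≢c c′≢d d′≢c d′≢d with CyclicConsecutive-splice⁻ cd
      ... | inj₁ (refl , refl) = here
      ... | inj₂ (inj₁ (refl , refl)) = there here
      ... | inj₂ (inj₂ (inj₁ (refl , refl))) = there (there here)
      ... | inj₂ (inj₂ (inj₂ cd′)) with CyclicConsecutive-4 cd′
      ...   | inj₁ (refl , refl) = ⊥-elim (spliced-¬edge u x∉ cd)
      ...   | inj₂ (inj₁ (refl , refl)) = ⊥-elim (d′≢c refl)
      ...   | inj₂ (inj₂ (inj₁ (refl , refl))) = ⊥-elim (c′≢c refl)
      ...   | inj₂ (inj₂ (inj₂ (refl , refl))) = ⊥-elim (c′≢d refl)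

  -- an ear of T′ disjoint from the edge a b survives attaching the ear a x y b to T′
  earAfterSplice : ∀ {a b x y z₁ z₂ rest} → RemovableEar (a ∷ b ∷ rest) a b → Unique (a ∷ x ∷ y ∷ b ∷ rest) →
    x ∉ a ∷ b ∷ rest → y ∉ a ∷ b ∷ rest → x ≢ y → Adj a x → Adj x y → Adj y b →
    z₁ ∈ a ∷ x ∷ y ∷ b ∷ [] → z₂ ∈ a ∷ x ∷ y ∷ b ∷ [] → RemovableEar (a ∷ x ∷ y ∷ b ∷ rest) z₁ z₂
  earAfterSplice {a} {b} {x} {y} {z₁} {z₂} {rest} R u x∉ y∉ x≢y a~x x~y y~b z₁∈ z₂∈ = record
    { a = R.a ; b = R.b ; s = R.s ; t = R.t ; rest = S.rest ; E₀ = _ ; base = S.tet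
    ; E₀⊆G = SubgraphOf-ear R.E₀⊆G a~x x~y y~b
    ; s∉ = ∉new R.s∉ s∉ear ; t∉ = ∉new R.t∉ t∉ear ; s≢t = R.s≢t
    ; a~s = R.a~s ; s~t = R.s~t ; t~b = R.t~b
    ; B⊆ = B⊆ ; ⊆B = ⊆B ; length≡ = cong (2 +_) (trans R.length≡ (sym S.length≡))
    ; s≢z₁ = λ { refl → s∉ear z₁∈ } ; s≢z₂ = λ { refl → s∉ear z₂∈ }
    ; t≢z₁ = λ { refl → t∉ear z₁∈ } ; t≢z₂ = λ { refl → t∉ear z₂∈ }
    ; others = others }
    where
    module R = RemovableEar R
    module S = Splice (Tet-splice R.base
                         (R.others (inner here) (R.s≢z₁ ∘ sym) (R.t≢z₁ ∘ sym) (R.s≢z₂ ∘ sym) (R.t≢z₂ ∘ sym))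
                                  (x∉ ∘ R.Base⊆B) (y∉ ∘ R.Base⊆B) x≢y)
    ∉ear : ∀ {w} → w ∈ a ∷ b ∷ rest → w ≢ a → w ≢ b → w ∉ a ∷ x ∷ y ∷ b ∷ []
    ∉ear w∈ w≢a w≢b (here w≡a) = w≢a w≡a
    ∉ear w∈ w≢a w≢b (there (here refl)) = x∉ w∈
    ∉ear w∈ w≢a w≢b (there (there (here refl))) = y∉ w∈
    ∉ear w∈ w≢a w≢b (there (there (there (here w≡b)))) = w≢b w≡b
    s∉ear = ∉ear R.s∈B R.s≢z₁ R.s≢z₂
    t∉ear = ∉ear R.t∈B R.t≢z₁ R.t≢z₂
    ∉new : ∀ {w} → w ∉ R.Base → w ∉ a ∷ x ∷ y ∷ b ∷ [] → w ∉ R.a ∷ R.b ∷ S.rest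
    ∉new w∉ w∉ear w∈ with S.rest⊆ w∈
    ... | inj₁ refl = w∉ear (there (here refl))
    ... | inj₂ (inj₁ refl) = w∉ear (there (there (here refl)))
    ... | inj₂ (inj₂ w∈′) = w∉ w∈′
    B⊆ : a ∷ x ∷ y ∷ b ∷ rest ⊆ R.a ∷ R.s ∷ R.t ∷ R.b ∷ S.rest
    B⊆ v∈ with ∈-splice⁻ [] v∈
    ... | inj₁ refl = ∈-splice⁺ [] S.x∈
    ... | inj₂ (inj₁ refl) = ∈-splice⁺ [] S.y∈
    ... | inj₂ (inj₂ v∈B′) with ∈-splice⁻ [] (R.B⊆ v∈B′)
    ...   | inj₁ refl = there (here refl)
    ...   | inj₂ (inj₁ refl) = there (there (here refl))
    ...   | inj₂ (inj₂ v∈base) = ∈-splice⁺ [] (S.⊆rest v∈base)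
    ⊆B : R.a ∷ R.s ∷ R.t ∷ R.b ∷ S.rest ⊆ a ∷ x ∷ y ∷ b ∷ rest
    ⊆B v∈ with ∈-splice⁻ [] v∈
    ... | inj₁ refl = ∈-splice⁺ [] R.s∈B
    ... | inj₂ (inj₁ refl) = ∈-splice⁺ [] R.t∈B
    ... | inj₂ (inj₂ v∈new) with S.rest⊆ v∈new
    ...   | inj₁ refl = there (here refl)
    ...   | inj₂ (inj₁ refl) = there (there (here refl))
    ...   | inj₂ (inj₂ v∈base) = ∈-splice⁺ [] (R.Base⊆B v∈base)
    others : ∀ {c d} → CyclicConsecutive c d (a ∷ x ∷ y ∷ b ∷ rest) → c ≢ R.s → c ≢ R.t → d ≢ R.s → d ≢ R.t →
             Consecutive c d (R.b ∷ S.rest ++ [ R.a ])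
    others cd c≢s c≢t d≢s d≢t with CyclicConsecutive-splice⁻ cd
    ... | inj₁ ax = S.ear (inj₁ ax)
    ... | inj₂ (inj₁ xy) = S.ear (inj₂ (inj₁ xy))
    ... | inj₂ (inj₂ (inj₁ yb)) = S.ear (inj₂ (inj₂ yb))
    ... | inj₂ (inj₂ (inj₂ cd′)) with S.keeps (R.others cd′ c≢s c≢t d≢s d≢t)
    ...   | inj₁ (refl , refl) = ⊥-elim (spliced-¬edge u x∉ cd)
    ...   | inj₂ cd″ = cd″

  mutual
    removableEar : ∀ {E B z₁ z₂} → Tet E B → SubgraphOf G E → 5 ≤ length B → CycleEdge z₁ z₂ B →
                   RemovableEar B z₁ z₂
    removableEar (c4 _ _ _ _ _ _ _ _ _ _) _ (s≤s (s≤s (s≤s (s≤s ())))) _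
    removableEar (rot {v = v} {vs} T) E⊆G 5≤ z₁z₂ =
      RemovableEar-rotate ρ (removableEar T E⊆G (subst (5 ≤_) (sym (Rotation-length ρ)) 5≤)
                                          (Rotation-CycleEdge (Rotation-sym ρ) z₁z₂))
      where ρ = rotation₁ v vs
    removableEar {z₁ = z₁} {z₂} (ext x y T x∉ y∉ x≢y) E⊆G _ z₁z₂
      with x ∈? z₁ ∷ z₂ ∷ [] | y ∈? z₁ ∷ z₂ ∷ []
    ... | no x∉z | no y∉z = lastEar T E⊆G x∉ y∉ x≢y x∉z y∉z
    ... | yes x∈z | _ = earTouching T E⊆G x∉ y∉ x≢y (CycleEdge-touching z₁z₂ x∉ x∈z)
    ... | no _ | yes y∈z = earTouching T E⊆G x∉ y∉ x≢y (CycleEdge-touching z₁z₂ y∉ y∈z)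

    earTouching : ∀ {E₀ a b x y z₁ z₂ rest} → Tet E₀ (a ∷ b ∷ rest) →
                  SubgraphOf G ((a , x) ∷ (x , y) ∷ (y , b) ∷ E₀) →
                  x ∉ a ∷ b ∷ rest → y ∉ a ∷ b ∷ rest → x ≢ y →
                  z₁ ∈ a ∷ x ∷ y ∷ b ∷ [] × z₂ ∈ a ∷ x ∷ y ∷ b ∷ [] →
                  RemovableEar (a ∷ x ∷ y ∷ b ∷ rest) z₁ z₂
    earTouching {rest = []} T _ _ _ _ _ with s≤s (s≤s ()) ← boundary-length T
    earTouching {rest = _ ∷ []} T _ _ _ _ _ with s≤s (s≤s (s≤s ())) ← boundary-length T
    earTouching {rest = _ ∷ _ ∷ []} T E⊆G x∉ y∉ x≢y (z₁∈ , z₂∈) =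
      hexagonEar T (λ e∈ → E⊆G (there (there (there e∈)))) x∉ y∉ x≢y
                 (E⊆G (here refl)) (E⊆G (there (here refl))) (E⊆G (there (there (here refl)))) z₁∈ z₂∈
    earTouching {rest = _ ∷ _ ∷ _ ∷ _} T E⊆G x∉ y∉ x≢y (z₁∈ , z₂∈) =
      earAfterSplice (removableEar T (λ e∈ → E⊆G (there (there (there e∈)))) (s≤s (s≤s (s≤s (s≤s (s≤s z≤n)))))
                                   (inj₁ (inner here)))
                     (boundary-Unique (ext _ _ T x∉ y∉ x≢y)) x∉ y∉ x≢y
                     (E⊆G (here refl)) (E⊆G (there (here refl))) (E⊆G (there (there (here refl)))) z₁∈ z₂∈

  inB⇒∈ : ∀ {B v} → inB G B v ≡ true → v ∈ B
  inB⇒∈ {B} {v} with v ∈? B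
  ... | yes v∈B = λ _ → v∈B
  ... | no _ = λ ()

  ∈⇒inB : ∀ {B v} → v ∈ B → inB G B v ≡ true
  ∈⇒inB {B} {v} v∈B with v ∈? B
  ... | yes _ = refl
  ... | no v∉B = ⊥-elim (v∉B v∈B)

  ∉⇒inB : ∀ {B v} → v ∉ B → inB G B v ≡ false
  ∉⇒inB {B} {v} v∉B with v ∈? B
  ... | yes v∈B = ⊥-elim (v∉B v∈B)
  ... | no _ = refl

  degT≡countᵇ : ∀ {B} v → Unique B → degT G B v ≡ countᵇ (adj v) B
  degT≡countᵇ {B} v u = trans (length-filterᵇ _ (allFin n)) (≤-antisym
    (countᵇ-injection (allFin n) B (allFin⁺ n) λ {x} _ e → inB⇒∈ (∧-conicalˡ _ _ e) , ∧-conicalʳ (inB G B x) _ e)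
    (countᵇ-injection B (allFin n) u λ {x} x∈B e → ∈-allFin x , subst (λ b → b ∧ adj v x ≡ true) (sym (∈⇒inB x∈B)) e))

  degT≤half : ∀ {E B m} v → Tet E B → SubgraphOf G E → length B ≡ m + m → degT G B v ≤ m
  degT≤half {B = B} {m} v T E⊆G len = subst (_≤ m) (sym (degT≡countᵇ v (boundary-Unique T)))
    (subst (countᵇ (adj v) B ≤_) (Linked-balanced (opposite-step v) m B (boundary-Linked T E⊆G) len)
           (countᵇ-mono B λ _ → Adj⇒opposite))

  record AllButOne (u : V) (B : List V) : Set where
    field
      missed : V
      missed∈B : missed ∈ B
      missed-opposite : opposite u missed ≡ true
      adj-others : ∀ {c} → c ∈ B → opposite u c ≡ true → c ≢ missed → Adj u c

  saturated : ∀ {u B} → countᵇ (opposite u) B ≤ countᵇ (adj u) B →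
              ∀ {c} → c ∈ B → opposite u c ≡ true → Adj u c
  saturated {B = B} = countᵇ-mono-tight B λ _ → Adj⇒opposite

  AllButOne-from-degree : ∀ {u B} k → countᵇ (opposite u) B ≡ suc k → 0 < k → k ≤ countᵇ (adj u) B → AllButOne u B
  AllButOne-from-degree {u} {B} k opp≡ 0<k k≤deg with findᵇ (λ c → opposite u c ∧ not (adj u c)) B
  ... | inj₂ none with c , c∈B , u~c ← countᵇ-witness B (≤-trans 0<k k≤deg) = record
    { missed = c ; missed∈B = c∈B ; missed-opposite = Adj⇒opposite u~c
    ; adj-others = λ {c′} c′∈B opp _ → not-injective (subst (λ o → o ∧ not (adj u c′) ≡ false) opp (none c′∈B)) }
  ... | inj₁ (c₀ , c₀∈B , c₀-missed) with ys , zs , refl ← ∈-∃++ c₀∈B = record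
    { missed = c₀ ; missed∈B = c₀∈B ; missed-opposite = c₀-opp
    ; adj-others = λ c∈B opp c≢c₀ → saturated opp≤adj (drop c∈B c≢c₀) opp }
    where
    c₀-opp = ∧-conicalˡ _ _ c₀-missed
    opp≤adj : countᵇ (opposite u) (ys ++ zs) ≤ countᵇ (adj u) (ys ++ zs)
    opp≤adj = subst₂ _≤_ (sym (suc-injective (trans (sym (countᵇ-insert-true ys zs c₀-opp)) opp≡)))
                         (countᵇ-insert-false ys zs (not-injective (∧-conicalʳ _ _ c₀-missed))) k≤deg
    drop : ∀ {c} → c ∈ ys ++ c₀ ∷ zs → c ≢ c₀ → c ∈ ys ++ zs
    drop c∈ c≢c₀ with ∈-++⁻ ys c∈
    ... | inj₁ c∈ys = ∈-++⁺ˡ c∈ys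
    ... | inj₂ (here c≡c₀) = ⊥-elim (c≢c₀ c≡c₀)
    ... | inj₂ (there c∈zs) = ∈-++⁺ʳ ys c∈zs

  CycleEdge-Adj : ∀ {E B c d} → Tet E B → SubgraphOf G E → CycleEdge c d B → Adj c d
  CycleEdge-Adj T E⊆G (inj₁ cd) = boundary-Adj T E⊆G cd
  CycleEdge-Adj T E⊆G (inj₂ dc) = Adj-sym (boundary-Adj T E⊆G dc)

  other-boundary-neighbour : ∀ {E B} {t : V} → Tet E B → t ∈ B → ∀ x → ∃ λ s → CycleEdge t s B × s ≢ x
  other-boundary-neighbour T t∈B x
    with s₁ , s₂ , s₁t , ts₂ , s₁≢s₂
           ← cyclic-neighbours t∈B (boundary-Unique T) (≤-trans (n≤1+n 3) (boundary-length T))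
    with s₁ ≟ x
  ... | yes refl = s₂ , inj₁ ts₂ , λ s₂≡x → s₁≢s₂ (sym s₂≡x)
  ... | no s₁≢x = s₁ , inj₂ s₁t , s₁≢x

  -- t w r s is an ear, where s is a boundary neighbour of t other than the vertex missed by r
  Optimal-AllButOne-isolated : ∀ {E B r w t} → Optimal G E B → AllButOne r B → r ∉ B → w ∉ B → w ≢ r →
                               Adj w r → t ∈ B → Adj w t → ⊥
  Optimal-AllButOne-isolated {r = r} opt@((T , E⊆G) , _) R r∉ w∉ w≢r w~r t∈B w~t
    with s , ts , s≢missed ← other-boundary-neighbour T t∈B (AllButOne.missed R) =
    Optimal-no-ear opt ts w∉ r∉ w≢r (Adj-sym w~t) w~r (adj-others (CycleEdge⇒∈ʳ ts) opp-s s≢missed)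
    where
    open AllButOne R
    opp-s : opposite r s ≡ true
    opp-s = trans (opposite-step r (CycleEdge-Adj T E⊆G ts))
                  (cong not (trans (opposite-step² r (Adj-sym w~r) w~t) (opposite-self r)))

  record FanExtension (L Q : List V) : Set where
    field
      E′ : List (V × V)
      L′ : List V
      tet : Tet E′ L′
      E′⊆G : SubgraphOf G E′
      length≡ : length L′ ≡ length Q + length L
      L′⊆ : ∀ {v} → v ∈ L′ → v ∈ Q ⊎ v ∈ L
      ⊆L′ : L ⊆ L′
      Q⊆L′ : Q ⊆ L′

  -- the ears q y₁ x₁ h, x₁ y₂ x₂ h, … for Q = y₁ x₁ y₂ x₂ …, all hanging from the hub h
  attachFan : ∀ {E L h q} j Q → Tet E L → SubgraphOf G E → CycleEdge h q L → Linked (q ∷ Q) → length Q ≡ j + j →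
              opposite h q ≡ true → (∀ {c} → c ∈ Q → opposite h c ≡ true → Adj h c) →
              Unique Q → (∀ {v} → v ∈ Q → v ∉ L) → FanExtension L Q
  attachFan {E} {L} zero [] T E⊆G _ _ _ _ _ _ _ = record
    { E′ = E ; L′ = L ; tet = T ; E′⊆G = E⊆G ; length≡ = refl
    ; L′⊆ = inj₂ ; ⊆L′ = λ v∈ → v∈ ; Q⊆L′ = λ () }
  attachFan zero (_ ∷ _) _ _ _ _ () _ _ _ _
  attachFan (suc j) [] _ _ _ _ () _ _ _ _
  attachFan (suc j) (_ ∷ []) _ _ _ _ len _ _ _ _ with () ← trans (suc-injective len) (+-suc j j)
  attachFan {L = L} {h} {q} (suc j) (y ∷ x ∷ Q) T E⊆G hq linked len opp-q h~Q u@(y∉ ∷ x∉ ∷ uQ) fresh = record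
    { E′ = F.E′ ; L′ = F.L′ ; tet = F.tet ; E′⊆G = F.E′⊆G
    ; length≡ = trans F.length≡ (trans (cong (length Q +_) X.length≡)
                  (trans (+-suc (length Q) (suc (length L))) (cong suc (+-suc (length Q) (length L)))))
    ; L′⊆ = L′⊆ ; ⊆L′ = F.⊆L′ ∘ X.⊆L′
    ; Q⊆L′ = λ { (here refl) → F.⊆L′ X.x∈L′
               ; (there (here refl)) → F.⊆L′ X.y∈L′
               ; (there (there v∈Q)) → F.Q⊆L′ v∈Q } }
    where
    opp-x = trans (opposite-step² h (linked here) (linked (there here))) opp-q
    module X = EarExtension (attachEar T E⊆G (CycleEdge-sym hq) (fresh (here refl)) (fresh (there (here refl)))
                               (λ y≡x → Unique[x∷xs]⇒x∉xs u (here y≡x))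
                               (linked here) (linked (there here)) (Adj-sym (h~Q (there (here refl)) opp-x)))
    fresh′ : ∀ {v} → v ∈ Q → v ∉ X.L′
    fresh′ v∈Q v∈ with X.L′⊆ v∈
    ... | inj₁ refl = Unique[x∷xs]⇒x∉xs u (there v∈Q)
    ... | inj₂ (inj₁ refl) = Unique[x∷xs]⇒x∉xs (x∉ ∷ uQ) v∈Q
    ... | inj₂ (inj₂ v∈L) = fresh (there (there v∈Q)) v∈L
    module F = FanExtension (attachFan j Q X.tet X.E′⊆G (CycleEdge-sym X.y-q) (λ c → linked (there (there c)))
                               (double-pred len) opp-x (λ v∈ → h~Q (there (there v∈))) uQ fresh′)
    L′⊆ : ∀ {v} → v ∈ F.L′ → v ∈ y ∷ x ∷ Q ⊎ v ∈ L
    L′⊆ v∈ with F.L′⊆ v∈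
    ... | inj₁ v∈Q = inj₁ (there (there v∈Q))
    ... | inj₂ v∈X with X.L′⊆ v∈X
    ...   | inj₁ refl = inj₁ (here refl)
    ...   | inj₂ (inj₁ refl) = inj₁ (there (here refl))
    ...   | inj₂ (inj₂ v∈L) = inj₂ v∈L

  attachEar-at : ∀ {E L e z h x₀} → Tet E L → SubgraphOf G E → e ∈ L → z ∉ L → h ∉ L → h ≢ z →
                 Adj e z → Adj h z → opposite h e ≡ false →
                 (∀ {c} → c ∈ L → opposite h c ≡ true → c ≢ x₀ → Adj h c) →
                 ∃ λ p → p ∈ L × Adj h p × EarExtension L p h z e
  attachEar-at {h = h} {x₀} T E⊆G e∈L z∉ h∉ h≢z e~z h~z opp-e h~L
    with p , ep , p≢x₀ ← other-boundary-neighbour T e∈L x₀ = p , p∈L , h~p ,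
         attachEar T E⊆G (CycleEdge-sym ep) h∉ z∉ h≢z (Adj-sym h~p) h~z (Adj-sym e~z)
    where
    p∈L = CycleEdge⇒∈ʳ ep
    h~p = h~L p∈L (trans (opposite-step h (CycleEdge-Adj T E⊆G ep)) (cong not opp-e)) p≢x₀

  -- the ear of R listed as e z z′ e′, with z on the side opposite to h
  record OrientedEar {B z₁ z₂} (R : RemovableEar B z₁ z₂) (h : V) : Set where
    field
      e z z′ e′ : V
      z∈B : z ∈ B
      z′∈B : z′ ∈ B
      z∉ : z ∉ RemovableEar.Base R
      z′∉ : z′ ∉ RemovableEar.Base R
      z≢z′ : z ≢ z′
      e-e′ : CycleEdge e e′ (RemovableEar.Base R)
      e≢e′ : e ≢ e′
      e~z : Adj e z
      z~z′ : Adj z z′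
      z′~e′ : Adj z′ e′
      z≢z₁ : z ≢ z₁
      z′≢z₂ : z′ ≢ z₂
      opp-z : opposite h z ≡ true

  orient : ∀ {B z₁ z₂} (R : RemovableEar B z₁ z₂) h → OrientedEar R h
  orient R h with opposite h (RemovableEar.s R) in opp-s
  ... | true = record
    { e = a ; z = s ; z′ = t ; e′ = b ; z∈B = s∈B ; z′∈B = t∈B ; z∉ = s∉ ; z′∉ = t∉ ; z≢z′ = s≢t
    ; e-e′ = inj₁ (inner here) ; e≢e′ = a≢b ; e~z = a~s ; z~z′ = s~t ; z′~e′ = t~b
    ; z≢z₁ = s≢z₁ ; z′≢z₂ = t≢z₂ ; opp-z = opp-s }
    where open RemovableEar R
  ... | false = record
    { e = b ; z = t ; z′ = s ; e′ = a ; z∈B = t∈B ; z′∈B = s∈B ; z∉ = t∉ ; z′∉ = s∉ ; z≢z′ = s≢t ∘ sym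
    ; e-e′ = inj₂ (inner here) ; e≢e′ = a≢b ∘ sym ; e~z = Adj-sym t~b ; z~z′ = Adj-sym s~t ; z′~e′ = Adj-sym a~s
    ; z≢z₁ = t≢z₁ ; z′≢z₂ = s≢z₂ ; opp-z = trans (opposite-step h s~t) (cong not opp-s) }
    where open RemovableEar R

  -- replacing a removable ear by another ear keeps the size; a further ear then beats T
  Optimal-no-ear-after-swap : ∀ {E B z₁ z₂ p x y q c d x′ y′} → Optimal G E B → (R : RemovableEar B z₁ z₂) →
    (X : EarExtension (RemovableEar.Base R) p x y q) → CycleEdge c d (EarExtension.L′ X) →
    x′ ∉ EarExtension.L′ X → y′ ∉ EarExtension.L′ X → x′ ≢ y′ → Adj c x′ → Adj x′ y′ → Adj y′ d → ⊥
  Optimal-no-ear-after-swap {B = B} opt R X cd x′∉ y′∉ x′≢y′ c~x′ x′~y′ y′~d =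
    <⇒≱ longer (Optimal-longest opt Y.tet Y.E′⊆G)
    where
    module X = EarExtension X
    module Y = EarExtension (attachEar X.tet X.E′⊆G cd x′∉ y′∉ x′≢y′ c~x′ x′~y′ y′~d)
    longer : length B < length Y.L′
    longer = subst (length B <_) (sym (trans Y.length≡ (cong (2 +_) (trans X.length≡ (sym (RemovableEar.length≡ R))))))
                   (s≤s (n≤1+n _))

  -- lt: u < v; eu, ev: u, v is the vertex w added to X; xu, xv: u, v ∈ X; a: adj u v
  edge-untouched : ∀ lt eu ev xu xv a → (eu ≡ true → xu ≡ false) → (ev ≡ true → xv ≡ false) →
                   (lt ∧ (eu ∨ xu) ∧ (ev ∨ xv) ∧ a) ∧ not (eu ∨ ev) ≡ lt ∧ xu ∧ xv ∧ a
  edge-untouched lt false false xu xv a _ _ = ∧-identityʳ _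
  edge-untouched lt true ev xu xv a ¬xu _ rewrite ¬xu refl = trans (∧-zeroʳ _) (sym (∧-zeroʳ lt))
  edge-untouched lt false true xu xv a _ ¬xv rewrite ¬xv refl =
    trans (∧-zeroʳ _) (sym (trans (cong (lt ∧_) (∧-zeroʳ xu)) (∧-zeroʳ lt)))

  edge-touching-first : ∀ lt eu ev xu xv a → (eu ≡ true → ev ≡ true → lt ≡ false) →
                        ((lt ∧ (eu ∨ xu) ∧ (ev ∨ xv) ∧ a) ∧ (eu ∨ ev)) ∧ eu ≡ eu ∧ (lt ∧ xv ∧ a)
  edge-touching-first lt false ev xu xv a _ = ∧-zeroʳ _
  edge-touching-first lt true false xu xv a _ = trans (∧-identityʳ _) (∧-identityʳ _)
  edge-touching-first lt true true xu xv a ¬lt rewrite ¬lt refl refl = refl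

  edge-touching-second : ∀ lt eu ev xu xv a → (eu ≡ true → xu ≡ false) →
                         ((lt ∧ (eu ∨ xu) ∧ (ev ∨ xv) ∧ a) ∧ (eu ∨ ev)) ∧ not eu ≡ (lt ∧ xu ∧ a) ∧ ev
  edge-touching-second lt true ev xu xv a ¬xu rewrite ¬xu refl = trans (∧-zeroʳ _) (sym (cong (_∧ ev) (∧-zeroʳ lt)))
  edge-touching-second lt false false xu xv a _ = trans (∧-identityʳ _) (trans (∧-zeroʳ _) (sym (∧-zeroʳ _)))
  edge-touching-second lt false true xu xv a _ = ∧-identityʳ _

  Pairs : List (V × V)
  Pairs = cartesianProduct (allFin n) (allFin n)

  _<ⱽ_ : V → V → Bool
  u <ⱽ v = toℕ u <ᵇ toℕ v

  edgeIn : (V → Bool) → V × V → Bool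
  edgeIn X (u , v) = (u <ⱽ v) ∧ X u ∧ X v ∧ adj u v

  inducedEdges≡ : ∀ L → inducedEdges G L ≡ countᵇ (edgeIn (inB G L)) Pairs
  inducedEdges≡ L = trans (length-filterᵇ _ Pairs) (countᵇ-cong Pairs λ _ → refl)

  inducedEdges-cong : ∀ {L L′} → L ⊆ L′ → L′ ⊆ L → inducedEdges G L ≡ inducedEdges G L′
  inducedEdges-cong {L} {L′} L⊆ ⊆L = trans (inducedEdges≡ L) (trans (countᵇ-cong Pairs same) (sym (inducedEdges≡ L′)))
    where
    inB-cong : ∀ u → inB G L u ≡ inB G L′ u
    inB-cong u with inB G L u in u∈L | inB G L′ u in u∈L′
    ... | true | true = refl
    ... | false | false = refl
    ... | true | false with () ← trans (sym (∈⇒inB (L⊆ (inB⇒∈ u∈L)))) u∈L′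
    ... | false | true with () ← trans (sym (∈⇒inB (⊆L (inB⇒∈ u∈L′)))) u∈L
    same : ∀ {p} → p ∈ Pairs → edgeIn (inB G L) p ≡ edgeIn (inB G L′) p
    same {u , v} _ = cong₂ (λ x y → (u <ⱽ v) ∧ x ∧ y ∧ adj u v) (inB-cong u) (inB-cong v)

  module _ (X : V → Bool) (w : V) (X-w : X w ≡ false) where

    private
      is-w : V → Bool
      is-w u = does (u ≟ w)

      is-w⇒≡ : ∀ {u} → is-w u ≡ true → u ≡ w
      is-w⇒≡ {u} e with u ≟ w
      ... | yes u≡w = u≡w
      ... | no _ with () ← e

      is-w-∧ˡ : ∀ u (F : V → Bool) → is-w u ∧ F u ≡ is-w u ∧ F w
      is-w-∧ˡ u F with u ≟ w
      ... | yes refl = refl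
      ... | no _ = refl

      is-w-∧ʳ : ∀ u (F : V → Bool) → F u ∧ is-w u ≡ F w ∧ is-w u
      is-w-∧ʳ u F with u ≟ w
      ... | yes refl = refl
      ... | no _ = trans (∧-zeroʳ _) (sym (∧-zeroʳ _))

      is-w-w : is-w w ≡ true
      is-w-w with w ≟ w
      ... | yes _ = refl
      ... | no w≢w = ⊥-elim (w≢w refl)

      ¬X : ∀ {u} → is-w u ≡ true → X u ≡ false
      ¬X e = trans (cong X (is-w⇒≡ e)) X-w

      touches-w : V × V → Bool
      touches-w (u , v) = is-w u ∨ is-w v

      edgeIn′ = edgeIn (λ u → is-w u ∨ X u)

      ends : V → Bool
      ends v = (w <ⱽ v) ∧ X v ∧ adj w v

      starts : V → Bool
      starts u = (u <ⱽ w) ∧ X u ∧ adj u w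

      -- the edges between w and X, counted once from each end by the order on V
      edges-at-w : countᵇ (λ p → edgeIn′ p ∧ touches-w p) Pairs ≡ countᵇ (λ v → X v ∧ adj w v) (allFin n)
      edges-at-w = begin
        countᵇ (λ p → edgeIn′ p ∧ touches-w p) Pairs
          ≡⟨ countᵇ-split _ (is-w ∘ proj₁) Pairs ⟩
        countᵇ (λ p → (edgeIn′ p ∧ touches-w p) ∧ is-w (proj₁ p)) Pairs +
        countᵇ (λ p → (edgeIn′ p ∧ touches-w p) ∧ not (is-w (proj₁ p))) Pairs
          ≡⟨ cong₂ _+_ (countᵇ-cong Pairs first) (countᵇ-cong Pairs second) ⟩
        countᵇ (λ p → is-w (proj₁ p) ∧ ends (proj₂ p)) Pairs + countᵇ (λ p → starts (proj₁ p) ∧ is-w (proj₂ p)) Pairs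
          ≡⟨ cong₂ _+_ (countᵇ-cartesianProduct is-w ends all all) (countᵇ-cartesianProduct starts is-w all all) ⟩
        countᵇ is-w all * countᵇ ends all + countᵇ starts all * countᵇ is-w all
          ≡⟨ cong₂ _+_ (trans (cong (_* countᵇ ends all) one-w) (+-identityʳ _))
                       (trans (cong (countᵇ starts all *_) one-w) (*-identityʳ _)) ⟩
        countᵇ ends all + countᵇ starts all
          ≡⟨ sym (trans (countᵇ-split (λ v → X v ∧ adj w v) (w <ⱽ_) all)
                        (cong₂ _+_ (countᵇ-cong all later) (countᵇ-cong all earlier))) ⟩
        countᵇ (λ v → X v ∧ adj w v) all ∎
        where
        open ≡-Reasoning
        all = allFin n
        first : ∀ {p} → p ∈ Pairs → (edgeIn′ p ∧ touches-w p) ∧ is-w (proj₁ p) ≡ is-w (proj₁ p) ∧ ends (proj₂ p)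
        first {u , v} _ = trans (edge-touching-first (u <ⱽ v) (is-w u) (is-w v) (X u) (X v) (adj u v) loop)
                                (is-w-∧ˡ u (λ u′ → (u′ <ⱽ v) ∧ X v ∧ adj u′ v))
          where loop = λ eu ev → trans (cong₂ _<ⱽ_ (is-w⇒≡ {u} eu) (is-w⇒≡ {v} ev)) (<ᵇ-irrefl (toℕ w))
        second : ∀ {p} → p ∈ Pairs →
                 (edgeIn′ p ∧ touches-w p) ∧ not (is-w (proj₁ p)) ≡ starts (proj₁ p) ∧ is-w (proj₂ p)
        second {u , v} _ = trans (edge-touching-second (u <ⱽ v) (is-w u) (is-w v) (X u) (X v) (adj u v) ¬X)
                                 (is-w-∧ʳ v (λ v′ → (u <ⱽ v′) ∧ X u ∧ adj u v′))
        later : ∀ {v} → v ∈ all → (X v ∧ adj w v) ∧ (w <ⱽ v) ≡ ends v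
        later {v} _ = ∧-comm (X v ∧ adj w v) (w <ⱽ v)
        earlier : ∀ {v} → v ∈ all → (X v ∧ adj w v) ∧ not (w <ⱽ v) ≡ starts v
        earlier {v} _ with v ≟ w
        ... | yes refl rewrite X-w | <ᵇ-irrefl (toℕ w) = refl
        ... | no v≢w rewrite <ᵇ-flip (v≢w ∘ toℕ-injective) | adj-comm w v = ∧-comm (X v ∧ adj v w) (v <ⱽ w)
        one-w : countᵇ is-w all ≡ 1
        one-w = countᵇ-unique all (allFin⁺ n) (∈-allFin w) is-w-w λ _ → is-w⇒≡

    edgeIn-insert : countᵇ (edgeIn (λ u → is-w u ∨ X u)) Pairs ≡
                    countᵇ (edgeIn X) Pairs + countᵇ (λ v → X v ∧ adj w v) (allFin n)
    edgeIn-insert = begin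
      countᵇ edgeIn′ Pairs
        ≡⟨ countᵇ-split edgeIn′ touches-w Pairs ⟩
      countᵇ (λ p → edgeIn′ p ∧ touches-w p) Pairs + countᵇ (λ p → edgeIn′ p ∧ not (touches-w p)) Pairs
        ≡⟨ cong₂ _+_ edges-at-w (countᵇ-cong Pairs untouched) ⟩
      countᵇ (λ v → X v ∧ adj w v) (allFin n) + countᵇ (edgeIn X) Pairs
        ≡⟨ +-comm (countᵇ (λ v → X v ∧ adj w v) (allFin n)) (countᵇ (edgeIn X) Pairs) ⟩
      countᵇ (edgeIn X) Pairs + countᵇ (λ v → X v ∧ adj w v) (allFin n) ∎
      where
      open ≡-Reasoning
      untouched : ∀ {p} → p ∈ Pairs → edgeIn′ p ∧ not (touches-w p) ≡ edgeIn X p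
      untouched {u , v} _ = edge-untouched (u <ⱽ v) (is-w u) (is-w v) (X u) (X v) (adj u v) ¬X ¬X

  inducedEdges-∷ : ∀ {w P} → w ∉ P → Unique P → inducedEdges G (w ∷ P) ≡ inducedEdges G P + countᵇ (adj w) P
  inducedEdges-∷ {w} {P} w∉P uP = begin
    inducedEdges G (w ∷ P)
      ≡⟨ inducedEdges≡ (w ∷ P) ⟩
    countᵇ (edgeIn (inB G (w ∷ P))) Pairs
      ≡⟨ edgeIn-insert (inB G P) w (∉⇒inB w∉P) ⟩
    countᵇ (edgeIn (inB G P)) Pairs + countᵇ (λ v → inB G P v ∧ adj w v) (allFin n)
      ≡⟨ cong₂ _+_ (sym (inducedEdges≡ P)) (trans (sym (length-filterᵇ _ (allFin n))) (degT≡countᵇ w uP)) ⟩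
    inducedEdges G P + countᵇ (adj w) P ∎
    where open ≡-Reasoning

-- Optimal tetragonal subgraphs

module Optimality (G : BipartiteGraph) {E : List (Fin (BipartiteGraph.n G) × Fin (BipartiteGraph.n G))}
                  {B : List (Fin (BipartiteGraph.n G))} (j : ℕ) (opt : Optimal G E B)
                  (len : length B ≡ (3 + j) + (3 + j)) where
  open Bipartite G public

  -- m = 3 + j makes 3 ≤ m hold by construction
  m k : ℕ
  m = 3 + j
  k = m ∸ 1

  T : Tet E B
  T = proj₁ (proj₁ opt)

  E⊆G : SubgraphOf G E
  E⊆G = proj₂ (proj₁ opt)

  B-unique : Unique B
  B-unique = boundary-Unique T

  balanced : ∀ u → countᵇ (opposite u) B ≡ m
  balanced u = Linked-balanced (opposite-step u) m B (boundary-Linked T E⊆G) len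

  balanced′ : ∀ u → countᵇ (not ∘ opposite u) B ≡ m
  balanced′ u = Linked-balanced (cong not ∘ opposite-step u) m B (boundary-Linked T E⊆G) len

  5≤|B| : 5 ≤ length B
  5≤|B| = subst (5 ≤_) (sym len) (+-mono-≤ (s≤s (s≤s (s≤s z≤n))) (s≤s (s≤s z≤n)))

  InR : V → Set
  InR v = inR G B m v ≡ true

  InR⇒∉ : ∀ {v} → InR v → v ∉ B
  InR⇒∉ {v} v∈R v∈B with () ← trans (sym (∧-conicalˡ _ _ v∈R)) (cong not (∈⇒inB v∈B))

  InR⇒degree : ∀ {v} → InR v → k ≤ countᵇ (adj v) B
  InR⇒degree {v} v∈R = subst (k ≤_) (degT≡countᵇ v B-unique)
                              (≤ᵇ⇒≤ k (degT G B v) (subst Bool.T (sym (∧-conicalʳ (not (inB G B v)) _ v∈R)) tt))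

  InR⇒AllButOne : ∀ {r} → InR r → AllButOne r B
  InR⇒AllButOne {r} r∈R = AllButOne-from-degree k (balanced r) (s≤s z≤n) (InR⇒degree r∈R)

  InR⇒neighbour : ∀ {r} → InR r → ∃ λ t → t ∈ B × Adj r t
  InR⇒neighbour r∈R = countᵇ-witness B (≤-trans (s≤s z≤n) (InR⇒degree r∈R))

  R-independent : ∀ u v → InR u → InR v → adj u v ≡ false
  R-independent u v u∈R v∈R with adj u v in u~v
  ... | false = refl
  ... | true with u ≟ v
  ...   | yes refl with () ← trans (sym u~v) (irrefl u)
  ...   | no u≢v with t , t∈B , v~t ← InR⇒neighbour v∈R =
    ⊥-elim (Optimal-AllButOne-isolated opt (InR⇒AllButOne u∈R) (InR⇒∉ u∈R) (InR⇒∉ v∈R) (u≢v ∘ sym)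
                                       (Adj-sym u~v) t∈B v~t)

  InR-≢ : ∀ {r v} → InR r → inR G B m v ≡ false → r ≢ v
  InR-≢ r∈R v∉R refl with () ← trans (sym r∈R) v∉R

  -- swap an ear of T for one through r₂, then hang r₁ v r₂ on the new boundary edge p r₂ or z r₂
  two-R-neighbours : ∀ {v r₁ r₂} → v ∉ B → inR G B m v ≡ false → InR r₁ → InR r₂ → r₁ ≢ r₂ →
                     Adj v r₁ → Adj v r₂ → ⊥
  two-R-neighbours {v} {r₁} {r₂} v∉B v∉R r₁∈R r₂∈R r₁≢r₂ v~r₁ v~r₂ =
    hang (attachEar-at base E₀⊆G (CycleEdge⇒∈ˡ e-e′) z∉ (outside r₂∉B) (∉-≢ r₂∉B z∈B)
                       e~z r₂~z (opposite-across r₂ e~z opp-z)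
                       λ c∈ opp c≢x₀ → M₂.adj-others (Base⊆B c∈) opp c≢x₀)
    where
    module M₁ = AllButOne (InR⇒AllButOne r₁∈R)
    module M₂ = AllButOne (InR⇒AllButOne r₂∈R)
    r₁∉B = InR⇒∉ r₁∈R
    r₂∉B = InR⇒∉ r₂∈R
    R = removableEar T E⊆G 5≤|B| (proj₁ (proj₂ (other-boundary-neighbour T M₂.missed∈B M₂.missed)))
    open RemovableEar R
    open OrientedEar (orient R r₂)
    outside : ∀ {w} → w ∉ B → w ∉ Base
    outside w∉B = w∉B ∘ Base⊆B
    r₂~z = M₂.adj-others z∈B opp-z z≢z₁
    same-side : ∀ c → opposite r₁ c ≡ opposite r₂ c
    same-side c = cong (Bool._xor side c) (common-neighbour⇒same-side v~r₁ v~r₂)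
    hang : (∃ λ p → p ∈ Base × Adj r₂ p × EarExtension Base p r₂ z e) → ⊥
    hang (p , p∈ , r₂~p , X) = hang-on (p ≟ M₁.missed)
      where
      r₁∉ = EarExtension-∉ X (outside r₁∉B) r₁≢r₂ (∉-≢ r₁∉B z∈B)
      v∉ = EarExtension-∉ X (outside v∉B) (InR-≢ r₂∈R v∉R ∘ sym) (∉-≢ v∉B z∈B)
      hang-on : Dec (p ≡ M₁.missed) → ⊥
      hang-on (no p≢x₁) =
        Optimal-no-ear-after-swap opt R X (EarExtension.p-x X) r₁∉ v∉ (InR-≢ r₁∈R v∉R)
          (Adj-sym (M₁.adj-others (Base⊆B p∈) (trans (same-side p) (Adj⇒opposite r₂~p)) p≢x₁)) (Adj-sym v~r₁) v~r₂
      hang-on (yes p≡x₁) =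
        Optimal-no-ear-after-swap opt R X (CycleEdge-sym (EarExtension.x-y X)) r₁∉ v∉ (InR-≢ r₁∈R v∉R)
          (Adj-sym (M₁.adj-others z∈B (trans (same-side z) opp-z) (λ z≡x₁ → ∉-≢ z∉ p∈ (trans z≡x₁ (sym p≡x₁)))))
          (Adj-sym v~r₁) v~r₂

  R-neighbour-unique : ∀ {v r₁ r₂} → v ∉ B → inR G B m v ≡ false → InR r₁ → InR r₂ →
                       Adj v r₁ → Adj v r₂ → r₁ ≡ r₂
  R-neighbour-unique v∉B v∉R r₁∈R r₂∈R v~r₁ v~r₂ with _ ≟ _
  ... | yes r₁≡r₂ = r₁≡r₂
  ... | no r₁≢r₂ = ⊥-elim (two-R-neighbours v∉B v∉R r₁∈R r₂∈R r₁≢r₂ v~r₁ v~r₂)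

  R-neighbour-isolated : ∀ {v r t} → v ∉ B → v ≢ r → InR r → Adj v r → t ∈ B → adj v t ≡ false
  R-neighbour-isolated {v} {r} {t} v∉B v≢r r∈R v~r t∈B with adj v t in v~t
  ... | false = refl
  ... | true = ⊥-elim (Optimal-AllButOne-isolated opt (InR⇒AllButOne r∈R) (InR⇒∉ r∈R) v∉B v≢r v~r t∈B v~t)

  outside-R : ∀ v → v ∉ B → inR G B m v ≡ false →
              (degP G (inR G B m) v ≡ 0 × degT G B v ≤ m ∸ 2) ⊎ (degP G (inR G B m) v ≡ 1 × degT G B v ≡ 0)
  outside-R v v∉B v∉R with findᵇ (λ u → inR G B m u ∧ adj v u) (allFin n)
  ... | inj₂ none = inj₁ (trans (length-filterᵇ _ (allFin n)) (countᵇ-none (allFin n) none) ,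
                          <⇒≤pred (≰⇒> below))
    where
    below : ¬ k ≤ degT G B v
    below k≤deg =
      subst Bool.T (trans (sym (cong (λ b → not b ∧ (k ≤ᵇ degT G B v)) (∉⇒inB v∉B))) v∉R) (≤⇒≤ᵇ k≤deg)
  ... | inj₁ (r , _ , r∈R∧v~r) = inj₂ (one , trans (degT≡countᵇ v B-unique) (countᵇ-none B isolated))
    where
    r∈R = ∧-conicalˡ _ _ r∈R∧v~r
    v~r = ∧-conicalʳ (inR G B m r) _ r∈R∧v~r
    isolated : ∀ {t} → t ∈ B → adj v t ≡ false
    isolated = R-neighbour-isolated v∉B (InR-≢ r∈R v∉R ∘ sym) r∈R v~r
    one : degP G (inR G B m) v ≡ 1
    one = trans (length-filterᵇ _ (allFin n)) (countᵇ-unique (allFin n) (allFin⁺ n) (∈-allFin r) r∈R∧v~r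
            λ _ found → R-neighbour-unique v∉B v∉R (∧-conicalˡ _ _ found) r∈R (∧-conicalʳ (inR G B m _) _ found) v~r)

  degree-m⇒sees-all : ∀ {v} → degT G B v ≡ m → ∀ {c} → c ∈ B → opposite v c ≡ true → Adj v c
  degree-m⇒sees-all {v} deg≡m =
    saturated (subst₂ _≤_ (sym (balanced v)) (trans (sym deg≡m) (degT≡countᵇ v B-unique)) ≤-refl)

  replace-boundary-vertex : ∀ {v b P} → v ∉ B → (∀ {c} → c ∈ B → opposite v c ≡ true → Adj v c) →
    Rotation B (b ∷ P) → Unique (b ∷ P) → opposite v b ≡ false →
    ∃₂ λ E′ L′ → TetSub G E′ L′ × length L′ ≡ length B × L′ ⊆ v ∷ P × v ∷ P ⊆ L′
  replace-boundary-vertex {P = []} _ _ ρ _ _ with s≤s () ← subst (5 ≤_) (Rotation-length ρ) 5≤|B|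
  replace-boundary-vertex {P = _ ∷ []} _ _ ρ _ _ with s≤s (s≤s ()) ← subst (5 ≤_) (Rotation-length ρ) 5≤|B|
  replace-boundary-vertex {P = _ ∷ _ ∷ []} _ _ ρ _ _ with s≤s (s≤s (s≤s ())) ← subst (5 ≤_) (Rotation-length ρ) 5≤|B|
  replace-boundary-vertex {v} {b} {p₁ ∷ p₂ ∷ p₃ ∷ Q} v∉B sees ρ (_ ∷ u₁@(_ ∷ u₂@(_ ∷ u₃@(_ ∷ uQ)))) opp-b =
    F.E′ , F.L′ , (F.tet , F.E′⊆G) , |L′| , L′⊆ , ⊆L′
    where
    P⊆B : ∀ {c} → c ∈ p₁ ∷ p₂ ∷ p₃ ∷ Q → c ∈ B
    P⊆B = Rotation-⊆ (Rotation-sym ρ) ∘ there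
    linked = boundary-Linked (Rotation-Tet ρ T) E⊆G
    opp-p₁ = trans (opposite-step v (linked here)) (cong not opp-b)
    opp-p₃ = trans (opposite-step² v (linked (there here)) (linked (there (there here)))) opp-p₁
    v≢ : ∀ {c} → c ∈ p₁ ∷ p₂ ∷ p₃ ∷ Q → v ≢ c
    v≢ c∈ refl = v∉B (P⊆B c∈)
    square : Tet ((v , p₁) ∷ (p₁ , p₂) ∷ (p₂ , p₃) ∷ (p₃ , v) ∷ []) (v ∷ p₁ ∷ p₂ ∷ p₃ ∷ [])
    square = c4 v p₁ p₂ p₃ (v≢ (here refl)) (v≢ (there (here refl))) (v≢ (there (there (here refl))))
                (λ e → Unique[x∷xs]⇒x∉xs u₁ (here e)) (λ e → Unique[x∷xs]⇒x∉xs u₁ (there (here e)))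
                (λ e → Unique[x∷xs]⇒x∉xs u₂ (here e))
    square⊆G : SubgraphOf G ((v , p₁) ∷ (p₁ , p₂) ∷ (p₂ , p₃) ∷ (p₃ , v) ∷ [])
    square⊆G (here refl) = sees (P⊆B (here refl)) opp-p₁
    square⊆G (there (here refl)) = linked (there here)
    square⊆G (there (there (here refl))) = linked (there (there here))
    square⊆G (there (there (there (here refl)))) = Adj-sym (sees (P⊆B (there (there (here refl)))) opp-p₃)
    fresh : ∀ {c} → c ∈ Q → c ∉ v ∷ p₁ ∷ p₂ ∷ p₃ ∷ []
    fresh c∈Q (here refl) = v∉B (P⊆B (there (there (there c∈Q))))
    fresh c∈Q (there (here refl)) = Unique[x∷xs]⇒x∉xs u₁ (there (there c∈Q))
    fresh c∈Q (there (there (here refl))) = Unique[x∷xs]⇒x∉xs u₂ (there c∈Q)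
    fresh c∈Q (there (there (there (here refl)))) = Unique[x∷xs]⇒x∉xs u₃ c∈Q
    module F = FanExtension (attachFan (suc j) Q square square⊆G (inj₂ (wrap (p₁ ∷ p₂ ∷ []) refl))
                 (λ c → linked (there (there (there c))))
                 (double-pred {k = suc j} (double-pred {k = 2 + j} (trans (sym (Rotation-length ρ)) len)))
                 opp-p₃ (λ c∈Q → sees (P⊆B (there (there (there c∈Q))))) uQ fresh)
    |L′| : length F.L′ ≡ length B
    |L′| = trans F.length≡ (trans (+-comm (length Q) 4) (sym (Rotation-length ρ)))
    L′⊆ : F.L′ ⊆ v ∷ p₁ ∷ p₂ ∷ p₃ ∷ Q
    L′⊆ c∈ with F.L′⊆ c∈
    ... | inj₁ c∈Q = there (there (there (there c∈Q)))
    ... | inj₂ c∈square = ∈-++⁺ˡ c∈square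
    ⊆L′ : v ∷ p₁ ∷ p₂ ∷ p₃ ∷ Q ⊆ F.L′
    ⊆L′ c∈ with ∈-++⁻ (v ∷ p₁ ∷ p₂ ∷ p₃ ∷ []) c∈
    ... | inj₁ c∈square = F.⊆L′ c∈square
    ... | inj₂ c∈Q = F.Q⊆L′ c∈Q

  -- otherwise v could replace b with more induced edges: v sees all m vertices across in P, b at most m - 1
  degree-m⇒complete : ∀ {v} → v ∉ B → degT G B v ≡ m →
                      ∀ {a b} → b ∈ B → opposite v b ≡ false → a ∈ B → opposite v a ≡ true → Adj b a
  degree-m⇒complete {v} v∉B deg≡m {a} {b} b∈B opp-b a∈B opp-a with adj b a in b~a
  ... | true = refl
  ... | false with P , ρ ← rotate-to-∈ b∈B
    with uP@(_ ∷ uP′) ← Rotation-Unique ρ B-unique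
    with E′ , L′ , TS , |L′| , L′⊆ , ⊆L′ ← replace-boundary-vertex v∉B (degree-m⇒sees-all deg≡m) ρ uP opp-b =
    ⊥-elim (not-¬ refl (trans (sym b-sees-a) b~a))
    where
    v∉P : v ∉ P
    v∉P = v∉B ∘ Rotation-⊆ (Rotation-sym ρ) ∘ there
    count-P : ∀ f → f b ≡ false → countᵇ f B ≡ countᵇ f P
    count-P f fb = trans (Rotation-countᵇ f ρ) (countᵇ-∷-false P fb)
    v-sees : countᵇ (adj v) P ≡ m
    v-sees = trans (sym (count-P (adj v) (¬opposite⇒¬Adj opp-b))) (trans (sym (degT≡countᵇ v B-unique)) deg≡m)
    edges-L′ : inducedEdges G L′ ≡ inducedEdges G P + m
    edges-L′ = trans (inducedEdges-cong L′⊆ ⊆L′) (trans (inducedEdges-∷ v∉P uP′) (cong (inducedEdges G P +_) v-sees))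
    edges-B : inducedEdges G B ≡ inducedEdges G P + countᵇ (adj b) P
    edges-B = trans (inducedEdges-cong (Rotation-⊆ ρ) (Rotation-⊆ (Rotation-sym ρ)))
                    (inducedEdges-∷ (Unique[x∷xs]⇒x∉xs uP) uP′)
    b-sees-m : countᵇ (opposite b) P ≤ countᵇ (adj b) P
    b-sees-m = subst (_≤ countᵇ (adj b) P) (trans (sym (balanced b)) (count-P (opposite b) (opposite-self b)))
                 (+-cancelˡ-≤ (inducedEdges G P) _ _ (subst₂ _≤_ edges-L′ edges-B (proj₂ (proj₂ opt E′ L′ TS) |L′|)))
    a∈P : a ∈ P
    a∈P with Rotation-⊆ ρ a∈B
    ... | here refl = ⊥-elim (not-¬ refl (trans (sym opp-a) opp-b))
    ... | there a∈P = a∈P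
    b-sees-a : Adj b a
    b-sees-a = saturated b-sees-m a∈P (trans (cong (Bool._xor side a) (¬opposite⇒same-side opp-b)) opp-a)

  degree-m⇒Kmm : ∀ {v} → v ∉ B → degT G B v ≡ m → InducedIsoKmm G B m
  degree-m⇒Kmm {v} v∉B deg≡m = σ , σ-injective , σ-∈ , σ-surjective , σ-adj
    where
    far near : List V
    far = filterᵇ (opposite v) B
    near = filterᵇ (not ∘ opposite v) B
    |far| : length far ≡ m
    |far| = trans (length-filterᵇ _ B) (balanced v)
    |near| : length near ≡ m
    |near| = trans (length-filterᵇ _ B) (balanced′ v)
    σ : Fin m ⊎ Fin m → V
    σ (inj₁ i) = enumerate far |far| i
    σ (inj₂ i) = enumerate near |near| i
    far-opp : ∀ i → opposite v (σ (inj₁ i)) ≡ true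
    far-opp i = proj₂ (∈-filterᵇ⁻ B (enumerate-∈ far |far| i))
    near-opp : ∀ i → opposite v (σ (inj₂ i)) ≡ false
    near-opp i = not-injective (proj₂ (∈-filterᵇ⁻ B (enumerate-∈ near |near| i)))
    σ-∈ : ∀ x → σ x ∈ B
    σ-∈ (inj₁ i) = proj₁ (∈-filterᵇ⁻ B (enumerate-∈ far |far| i))
    σ-∈ (inj₂ i) = proj₁ (∈-filterᵇ⁻ B (enumerate-∈ near |near| i))
    σ-injective : ∀ x y → σ x ≡ σ y → x ≡ y
    σ-injective (inj₁ i) (inj₁ i′) e = cong inj₁ (enumerate-injective |far| (Unique-filterᵇ B-unique) e)
    σ-injective (inj₂ i) (inj₂ i′) e = cong inj₂ (enumerate-injective |near| (Unique-filterᵇ B-unique) e)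
    σ-injective (inj₁ i) (inj₂ i′) e =
      ⊥-elim (not-¬ refl (trans (sym (far-opp i)) (trans (cong (opposite v) e) (near-opp i′))))
    σ-injective (inj₂ i) (inj₁ i′) e =
      ⊥-elim (not-¬ refl (trans (sym (far-opp i′)) (trans (cong (opposite v) (sym e)) (near-opp i))))
    σ-surjective : ∀ c → c ∈ B → ∃ λ x → σ x ≡ c
    σ-surjective c c∈B with opposite v c in opp-c
    ... | true with i , σi≡c ← enumerate-surjective |far| (∈-filterᵇ⁺ c∈B opp-c) = inj₁ i , σi≡c
    ... | false with i , σi≡c ← enumerate-surjective |near| (∈-filterᵇ⁺ c∈B (cong not opp-c)) = inj₂ i , σi≡c
    σ-adj : ∀ x y → adj (σ x) (σ y) ≡ Kadj G x y
    σ-adj (inj₁ i) (inj₁ i′) = opposite-≡⇒¬Adj v (trans (far-opp i) (sym (far-opp i′)))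
    σ-adj (inj₂ i) (inj₂ i′) = opposite-≡⇒¬Adj v (trans (near-opp i) (sym (near-opp i′)))
    σ-adj (inj₁ i) (inj₂ i′) =
      Adj-sym (degree-m⇒complete v∉B deg≡m (σ-∈ (inj₂ i′)) (near-opp i′) (σ-∈ (inj₁ i)) (far-opp i))
    σ-adj (inj₂ i) (inj₁ i′) =
      degree-m⇒complete v∉B deg≡m (σ-∈ (inj₂ i)) (near-opp i) (σ-∈ (inj₁ i′)) (far-opp i′)

  missed : ∀ {r} → InR r → V
  missed r∈R = AllButOne.missed (InR⇒AllButOne r∈R)

  -- swap an ear of T for one through u, then hang an ear through w next to it
  adjacent-misses : ∀ {u w} (u∈R : InR u) (w∈R : InR w) → side u ≢ side w →
                    CycleEdge (missed u∈R) (missed w∈R) B → ⊥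
  adjacent-misses {u} {w} u∈R w∈R su≢sw xᵤ-x =
    hang (attachEar-at base E₀⊆G (CycleEdge⇒∈ˡ e-e′) z∉ (outside u∉B) (∉-≢ u∉B z∈B) e~z u~z opp-u-e
                       λ c∈ opp c≢x → Mu.adj-others (Base⊆B c∈) opp c≢x)
    where
    module Mu = AllButOne (InR⇒AllButOne u∈R)
    module Mw = AllButOne (InR⇒AllButOne w∈R)
    u∉B = InR⇒∉ u∈R
    w∉B = InR⇒∉ w∈R
    R = removableEar T E⊆G 5≤|B| xᵤ-x
    open RemovableEar R
    open OrientedEar (orient R u)
    outside : ∀ {x} → x ∉ B → x ∉ Base
    outside x∉B = x∉B ∘ Base⊆B
    u~z = Mu.adj-others z∈B opp-z z≢z₁
    opp-u-e = opposite-across u e~z opp-z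
    opp-w-z′ = trans (opposite-flip su≢sw z′) (cong not (opposite-across u (Adj-sym z~z′) opp-z))
    w~z′ = Mw.adj-others z′∈B opp-w-z′ z′≢z₂
    hang : (∃ λ p → p ∈ Base × Adj u p × EarExtension Base p u z e) → ⊥
    hang (_ , _ , _ , X) = hang-on (e ≟ Mw.missed)
      where
      w∉L′ = EarExtension-∉ X (outside w∉B) (λ w≡u → su≢sw (cong side (sym w≡u))) (∉-≢ w∉B z∈B)
      z′∉L′ = EarExtension-∉ X z′∉ (∉-≢ u∉B z′∈B ∘ sym) (z≢z′ ∘ sym)
      w≢z′ = ∉-≢ w∉B z′∈B
      beside : (∃ λ s → CycleEdge e′ s Base × s ≢ e) → e ≡ Mw.missed → ⊥
      beside (s , e′s , s≢e) e≡x =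
        Optimal-no-ear-after-swap opt R X (EarExtension-keeps-edge X (CycleEdge-sym e′s) s≢e (e≢e′ ∘ sym))
          w∉L′ z′∉L′ w≢z′
          (Adj-sym (Mw.adj-others (Base⊆B (CycleEdge⇒∈ʳ e′s)) opp-w-s λ s≡x → s≢e (trans s≡x (sym e≡x))))
          w~z′ z′~e′
        where
        opp-w-s = trans (opposite-step w (CycleEdge-Adj base E₀⊆G e′s))
                        (cong not (opposite-across w (Adj-sym z′~e′) opp-w-z′))
      hang-on : Dec (e ≡ Mw.missed) → ⊥
      hang-on (no e≢x) =
        Optimal-no-ear-after-swap opt R X (CycleEdge-sym (EarExtension.y-q X)) w∉L′ z′∉L′ w≢z′
          (Adj-sym (Mw.adj-others (Base⊆B (CycleEdge⇒∈ˡ e-e′)) (trans (opposite-flip su≢sw e) (cong not opp-u-e)) e≢x))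
          w~z′ (Adj-sym z~z′)
      hang-on (yes e≡x) = beside (other-boundary-neighbour base (CycleEdge⇒∈ʳ e-e′) e) e≡x

  module DoubleFan {h₁ h₂ z d₂ d₃ d₄ d₅ d₀ K} (h₁∈R : InR h₁) (h₂∈R : InR h₂)
                   (s₁≢s₂ : side h₁ ≢ side h₂)
                   (ρ : Rotation B (z ∷ d₂ ∷ d₃ ∷ d₄ ∷ d₅ ∷ K ++ [ d₀ ])) (x₂≡z : missed h₂∈R ≡ z)
                   (x₁∉ : missed h₁∈R ∉ d₀ ∷ d₂ ∷ d₄ ∷ []) where
    private
      L : List V
      L = z ∷ d₂ ∷ d₃ ∷ d₄ ∷ d₅ ∷ K ++ [ d₀ ]
      module M₁ = AllButOne (InR⇒AllButOne h₁∈R)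
      module M₂ = AllButOne (InR⇒AllButOne h₂∈R)
      L⊆B = Rotation-⊆ (Rotation-sym ρ)
      h₁∉L = InR⇒∉ h₁∈R ∘ L⊆B
      h₂∉L = InR⇒∉ h₂∈R ∘ L⊆B
      TL = Rotation-Tet ρ T
      linked = boundary-Linked TL E⊆G
      uL = Rotation-Unique ρ B-unique
      d₀∈L : d₀ ∈ L
      d₀∈L = there (there (there (there (there (∈-++⁺ʳ K (here refl))))))
      K⊆L : ∀ {c} → c ∈ K → c ∈ L
      K⊆L c∈K = there (there (there (there (there (∈-++⁺ˡ c∈K)))))
      uK : Unique K
      uK = Unique-++⁻ˡ K (drop⁺ {xs = L} 5 uL)
      linked-K : Linked (d₅ ∷ K)
      linked-K c = linked (there (there (there (there (Consecutive-++⁺ʳ [ d₀ ] c)))))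
      K≢z : ∀ {c} → c ∈ K → c ≢ z
      K≢z c∈K refl = Unique[x∷xs]⇒x∉xs uL (there (there (there (there (∈-++⁺ˡ c∈K)))))
      opp₂-z : opposite h₂ z ≡ true
      opp₂-z = subst (λ x → opposite h₂ x ≡ true) x₂≡z M₂.missed-opposite
      opp₁-z : opposite h₁ z ≡ false
      opp₁-z = trans (opposite-flip (s₁≢s₂ ∘ sym) z) (cong not opp₂-z)
      opp₁-d₂ = trans (opposite-step h₁ (linked here)) (cong not opp₁-z)
      opp₂-d₃ = trans (opposite-step² h₂ (linked here) (linked (there here))) opp₂-z
      opp₂-d₅ = trans (opposite-step² h₂ (linked (there (there here))) (linked (there (there (there here))))) opp₂-d₃
      h₁~ : ∀ {c} → c ∈ L → opposite h₁ c ≡ true → c ∈ d₀ ∷ d₂ ∷ d₄ ∷ [] → Adj h₁ c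
      h₁~ c∈L opp c∈ = M₁.adj-others (L⊆B c∈L) opp λ { refl → x₁∉ c∈ }
      h₂~ : ∀ {c} → c ∈ L → opposite h₂ c ≡ true → c ≢ z → Adj h₂ c
      h₂~ c∈L opp c≢z = M₂.adj-others (L⊆B c∈L) opp λ c≡x → c≢z (trans c≡x x₂≡z)
      d₀~z = boundary-Adj TL E⊆G (wrap (d₂ ∷ d₃ ∷ d₄ ∷ d₅ ∷ K) refl)
      h₁~d₀ = h₁~ d₀∈L (trans (opposite-step h₁ (Adj-sym d₀~z)) (cong not opp₁-z)) (here refl)
      h₁~d₂ = h₁~ (there (here refl)) opp₁-d₂ (there (here refl))
      h₁~d₄ = h₁~ (there (there (there (here refl))))
                  (trans (opposite-step² h₁ (linked (there here)) (linked (there (there here)))) opp₁-d₂)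
                  (there (there (here refl)))

    -- the square h₁ d₀ z d₂ with the ears d₂ d₃ d₄ h₁ and d₃ h₂ d₅ d₄
    Octagon : Set
    Octagon = ∃₂ λ E′ L′ → TetSub G E′ L′ × length L′ ≡ 8 × CycleEdge h₂ d₅ L′ × (∀ {c} → c ∈ K → c ∉ L′)

    octagon : Unique L → Octagon
    octagon ((z≢d₂ ∷ z≢d₃ ∷ z≢d₄ ∷ z≢d₅ ∷ z≢Kd₀) ∷ (d₂≢d₃ ∷ d₂≢d₄ ∷ d₂≢d₅ ∷ d₂≢Kd₀)
             ∷ (d₃≢d₄ ∷ d₃≢d₅ ∷ d₃≢Kd₀)
             ∷ (d₄≢d₅ ∷ d₄≢Kd₀) ∷ d₅≢Kd₀ ∷ uKd₀) =
      X₂.E′ , X₂.L′ , (X₂.tet , X₂.E′⊆G) , trans X₂.length≡ (cong (2 +_) X₁.length≡) , X₂.x-y , fresh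
      where
      ≢d₀ : ∀ {x} → All (x ≢_) (K ++ [ d₀ ]) → x ≢ d₀
      ≢d₀ x≢ = All.lookup x≢ (∈-++⁺ʳ K (here refl))
      ≢K : ∀ {x c} → All (x ≢_) (K ++ [ d₀ ]) → c ∈ K → c ≢ x
      ≢K x≢ c∈K = All.lookup x≢ (∈-++⁺ˡ c∈K) ∘ sym
      h₁≢ : ∀ {c} → c ∈ L → c ≢ h₁
      h₁≢ c∈L = ∉-≢ h₁∉L c∈L ∘ sym
      h₂≢ : ∀ {c} → c ∈ L → h₂ ≢ c
      h₂≢ = ∉-≢ h₂∉L
      square : Tet _ (h₁ ∷ d₀ ∷ z ∷ d₂ ∷ [])
      square = c4 h₁ d₀ z d₂ (h₁≢ d₀∈L ∘ sym) (h₁≢ (here refl) ∘ sym) (h₁≢ (there (here refl)) ∘ sym)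
                  (≢d₀ z≢Kd₀ ∘ sym) (≢d₀ d₂≢Kd₀ ∘ sym) z≢d₂
      square⊆G : SubgraphOf G ((h₁ , d₀) ∷ (d₀ , z) ∷ (z , d₂) ∷ (d₂ , h₁) ∷ [])
      square⊆G (here refl) = h₁~d₀
      square⊆G (there (here refl)) = d₀~z
      square⊆G (there (there (here refl))) = linked here
      square⊆G (there (there (there (here refl)))) = Adj-sym h₁~d₂
      ear₁ = attachEar square square⊆G (inj₁ (wrap (d₀ ∷ z ∷ []) refl))
        (All¬⇒¬Any (h₁≢ (there (there (here refl))) ∷ ≢d₀ d₃≢Kd₀ ∷ (z≢d₃ ∘ sym) ∷ (d₂≢d₃ ∘ sym) ∷ []))
        (All¬⇒¬Any (h₁≢ (there (there (there (here refl)))) ∷ ≢d₀ d₄≢Kd₀ ∷ (z≢d₄ ∘ sym)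
                    ∷ (d₂≢d₄ ∘ sym) ∷ []))
        d₃≢d₄ (linked (there here)) (linked (there (there here))) (Adj-sym h₁~d₄)
      module X₁ = EarExtension ear₁
      ear₂ = attachEar X₁.tet X₁.E′⊆G X₁.x-y
        (EarExtension-∉ ear₁ (All¬⇒¬Any ((λ h₂≡h₁ → s₁≢s₂ (cong side (sym h₂≡h₁))) ∷ h₂≢ d₀∈L
                                          ∷ h₂≢ (here refl)
                                          ∷ h₂≢ (there (here refl)) ∷ []))
                             (h₂≢ (there (there (here refl)))) (h₂≢ (there (there (there (here refl))))))
        (EarExtension-∉ ear₁ (All¬⇒¬Any (h₁≢ (there (there (there (there (here refl))))) ∷ ≢d₀ d₅≢Kd₀
                                          ∷ (z≢d₅ ∘ sym)
                                          ∷ (d₂≢d₅ ∘ sym) ∷ []))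
                             (d₃≢d₅ ∘ sym) (d₄≢d₅ ∘ sym))
        (h₂≢ (there (there (there (there (here refl))))))
        (Adj-sym (h₂~ (there (there (here refl))) opp₂-d₃ (z≢d₃ ∘ sym)))
        (h₂~ (there (there (there (there (here refl))))) opp₂-d₅ (z≢d₅ ∘ sym))
        (Adj-sym (linked (there (there (there here)))))
      module X₂ = EarExtension ear₂
      fresh : ∀ {c} → c ∈ K → c ∉ X₂.L′
      fresh c∈K = EarExtension-∉ ear₂
        (EarExtension-∉ ear₁ (All¬⇒¬Any (h₁≢ (K⊆L c∈K) ∷ Unique-++⇒≢ K uKd₀ c∈K (here refl) ∷ ≢K z≢Kd₀ c∈K
                                          ∷ ≢K d₂≢Kd₀ c∈K ∷ []))
                             (≢K d₃≢Kd₀ c∈K) (≢K d₄≢Kd₀ c∈K))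
        (h₂≢ (K⊆L c∈K) ∘ sym) (≢K d₅≢Kd₀ c∈K)

    -- completing the octagon by the fan at h₂ over K gives |B| + 2 vertices
    contradiction : ⊥
    contradiction = fan (octagon uL)
      where
      |K+1| : length (K ++ [ d₀ ]) ≡ suc (length K)
      |K+1| = trans (length-++ K) (+-comm (length K) 1)
      |K| : length K ≡ j + j
      |K| = double-pred (trans (cong suc (sym |K+1|))
              (double-pred {k = 1 + j} (double-pred {k = 2 + j} (trans (sym (Rotation-length ρ)) len))))
      fan : Octagon → ⊥
      fan (_ , L′ , (T′ , E′⊆G) , |L′| , h₂d₅ , fresh) = <⇒≱ longer (Optimal-longest opt F.tet F.E′⊆G)
        where
        module F = FanExtension (attachFan j K T′ E′⊆G h₂d₅ linked-K |K| opp₂-d₅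
          (λ c∈K opp → h₂~ (K⊆L c∈K) opp (K≢z c∈K))
          uK fresh)
        longer : length B < length F.L′
        longer = subst₂ _<_ (sym (trans (Rotation-length ρ) (trans (cong (5 +_) |K+1|) (+-comm 6 (length K)))))
                            (sym (trans F.length≡ (cong (length K +_) |L′|)))
                            (+-monoʳ-< (length K) (m<n⇒m<1+n (n<1+n 6)))

  double-fan : ∀ {h₁ h₂ z d₂ d₃ d₄ d₅ d₀ K} (h₁∈R : InR h₁) (h₂∈R : InR h₂) → side h₁ ≢ side h₂ →
               Rotation B (z ∷ d₂ ∷ d₃ ∷ d₄ ∷ d₅ ∷ K ++ [ d₀ ]) → missed h₂∈R ≡ z →
               missed h₁∈R ∉ d₀ ∷ d₂ ∷ d₄ ∷ [] → ⊥
  double-fan {K = K} = DoubleFan.contradiction {K = K}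

  -- with the boundary listed from the vertex y₀ missed by w, a double fan fits unless the vertex missed by u
  -- is a boundary neighbour of y₀ (then `adjacent-misses` applies) or the third vertex p₄ after y₀ (then
  -- the roles of u and w are exchanged)
  opposite-sides : 1 ≤ j → ∀ {u w} (u∈R : InR u) (w∈R : InR w) → side u ≢ side w → ⊥
  opposite-sides 1≤j {u} {w} u∈R w∈R su≢sw with rotate-to-∈ (AllButOne.missed∈B (InR⇒AllButOne w∈R))
  ... | L , ρ with atLeast7 L 7≤L
    where
    7≤L = ≤-pred (subst (8 ≤_) (trans (sym len) (Rotation-length ρ))
                        (+-mono-≤ (+-monoʳ-≤ 3 1≤j) (+-monoʳ-≤ 3 1≤j)))
  ...   | p₂ ∷ p₃ ∷ p₄ ∷ p₅ ∷ p₆ ∷ p₇ ∷ K₃ ∷ʳ p₀ =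
    cases (missed u∈R ≟ p₂) (missed u∈R ≟ p₀) (missed u∈R ≟ p₄)
    where
    y₀ = missed w∈R
    ρ˘ = Rotation-sym ρ
    y₀∉ : y₀ ∉ p₂ ∷ p₃ ∷ p₄ ∷ p₅ ∷ p₆ ∷ p₇ ∷ K₃ ++ [ p₀ ]
    y₀∉ = Unique[x∷xs]⇒x∉xs (Rotation-Unique ρ B-unique)
    from-p₄ : ∃₂ λ d₅ K → Rotation B (p₄ ∷ p₅ ∷ p₆ ∷ p₇ ∷ d₅ ∷ K ++ [ p₃ ])
    from-p₄ = let d₅ , K , split = ∷-view K₃ p₀ (y₀ ∷ p₂ ∷ []) in
      d₅ , K , Rotation-trans ρ (y₀ ∷ p₂ ∷ p₃ ∷ [] , p₄ ∷ p₅ ∷ p₆ ∷ p₇ ∷ K₃ ++ [ p₀ ] , refl ,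
                                  cong (λ X → p₄ ∷ p₅ ∷ p₆ ∷ p₇ ∷ X) (begin
        (d₅ ∷ K) ++ [ p₃ ]                        ≡⟨ cong (_++ [ p₃ ]) split ⟨
        (K₃ ++ p₀ ∷ y₀ ∷ p₂ ∷ []) ++ [ p₃ ]       ≡⟨ ++-assoc K₃ (p₀ ∷ y₀ ∷ p₂ ∷ []) [ p₃ ] ⟩
        K₃ ++ p₀ ∷ y₀ ∷ p₂ ∷ p₃ ∷ []              ≡⟨ ++-assoc K₃ [ p₀ ] (y₀ ∷ p₂ ∷ p₃ ∷ []) ⟨
        (K₃ ++ [ p₀ ]) ++ y₀ ∷ p₂ ∷ p₃ ∷ []       ∎))
      where open ≡-Reasoning
    cases : Dec (missed u∈R ≡ p₂) → Dec (missed u∈R ≡ p₀) → Dec (missed u∈R ≡ p₄) → ⊥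
    cases (yes xᵤ≡p₂) _ _ =
      adjacent-misses u∈R w∈R su≢sw (inj₂ (subst (λ x → CyclicConsecutive y₀ x B) (sym xᵤ≡p₂)
                                                  (Rotation-CyclicConsecutive ρ˘ (inner here))))
    cases (no _) (yes xᵤ≡p₀) _ =
      adjacent-misses u∈R w∈R su≢sw (inj₁ (subst (λ x → CyclicConsecutive x y₀ B) (sym xᵤ≡p₀)
        (Rotation-CyclicConsecutive ρ˘ (wrap (p₂ ∷ p₃ ∷ p₄ ∷ p₅ ∷ p₆ ∷ p₇ ∷ K₃) refl))))
    cases (no xᵤ≢p₂) (no xᵤ≢p₀) (no xᵤ≢p₄) =
      double-fan {K = p₆ ∷ p₇ ∷ K₃} u∈R w∈R su≢sw ρ refl
        λ { (here e) → xᵤ≢p₀ e ; (there (here e)) → xᵤ≢p₂ e ; (there (there (here e))) → xᵤ≢p₄ e }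
    cases (no _) (no _) (yes xᵤ≡p₄) with d₅ , K , ρ′ ← from-p₄ =
      double-fan w∈R u∈R (su≢sw ∘ sym) ρ′ xᵤ≡p₄
        λ { (here refl) → y₀∉ (there (here refl)) ; (there (here refl)) → y₀∉ (there (there (there (here refl))))
          ; (there (there (here refl))) → y₀∉ (there (there (there (there (there (here refl)))))) }

  R-one-side : 1 ≤ j → ∃ λ (b : Bool) → ∀ v → InR v → side v ≡ b
  R-one-side 1≤j with findᵇ (inR G B m) (allFin n)
  ... | inj₂ none = true , λ v v∈R → ⊥-elim (not-¬ refl (trans (sym v∈R) (none (∈-allFin v))))
  ... | inj₁ (r , _ , r∈R) = side r , λ v v∈R → decidable-stable (side v Bool.≟ side r) (opposite-sides 1≤j v∈R r∈R)

mainTheorem12 : (G : BipartiteGraph)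
    (E : List (Fin (BipartiteGraph.n G) × Fin (BipartiteGraph.n G)))
    (B : List (Fin (BipartiteGraph.n G))) (m : ℕ) →
    Optimal G E B → length B ≡ m + m → 3 ≤ m →
    ((∀ v → v ∉ B → degT G B v ≤ m)
    × (∀ v → v ∉ B → degT G B v ≡ m → InducedIsoKmm G B m))
    × (∀ u v → inR G B m u ≡ true → inR G B m v ≡ true → BipartiteGraph.adj G u v ≡ false)
    × (4 ≤ m → ∃ λ (b : Bool) → ∀ v → inR G B m v ≡ true → BipartiteGraph.side G v ≡ b)
    × (∀ v → v ∉ B → inR G B m v ≡ false →
    (degP G (inR G B m) v ≡ 0 × degT G B v ≤ m ∸ 2)
    ⊎ (degP G (inR G B m) v ≡ 1 × degT G B v ≡ 0))
mainTheorem12 G E B (suc (suc (suc j))) opt len _ =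
  ((λ v _ → degT≤half v T E⊆G len) , (λ _ → degree-m⇒Kmm)) ,
  R-independent ,
  (λ 4≤m → R-one-side (≤-pred (≤-pred (≤-pred 4≤m)))) ,
  outside-R
  where
  open Optimality G j opt len
mainTheorem12 G E B 1 _ _ (s≤s ())
mainTheorem12 G E B 2 _ _ (s≤s (s≤s ()))
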